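{- Let $P$ and $Q$ be finite posets, and let $x \in P$ be such that $P - x$ is a fold of $P$, i.e., there exists $y \in P$ with $y \neq x$, $\mathcal{U}(y) \supseteq \mathcal{U}(x)$ and $\mathcal{D}(y) \supseteq \mathcal{D}(x)$. Then the barycentric subdivision $\mathrm{Bd}\,\mathrm{Hom}(P,Q)$ collapses onto $\mathrm{Bd}\,\mathrm{Hom}(P-x,Q)$, and $\mathrm{Hom}(Q,P)$ collapses onto $\mathrm{Hom}(Q,P-x)$.
   Context: For a finite poset $P$ and $z \in P$, $\mathcal{U}(z)$ denotes the set of elements of $P$ covering $z$ and $\mathcal{D}(z)$ the set of elements covered by $z$; $P-x$ denotes the induced subposet on $P\setminus\{x\}$. For finite posets $A,B$, the poset homomorphism complex $\mathrm{Hom}(A,B)$ is the following subcomplex of the product of simplices $\prod_{a\in A}\Delta_B$ (where $\Delta_B$ is the simplex with vertex set $B$): its cells are the tuples $(X_a)_{a\in A}$ of nonempty subsets $X_a\subseteq B$ such that every map $\eta:A\to B$ with $\eta(a)\in X_a$ for all $a$ is strictly order-preserving ($a<a'$ implies $\eta(a)<\eta(a')$); the cell $(X_a)$ is the product of the simplices $\Delta_{X_a}$, and cells are ordered by $X\le Y$ iff $X_a\subseteq Y_a$ for all $a$. $\mathrm{Bd}\,X$ denotes the barycentric subdivision of a polyhedral cell complex $X$, i.e. the order complex of its face poset. Here $\mathrm{Hom}(Q,P-x)$ is regarded as the subcomplex of $\mathrm{Hom}(Q,P)$ of cells not using $x$, and the face poset of $\mathrm{Hom}(P-x,Q)$ is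 identified with the subposet of the face poset of $\mathrm{Hom}(P,Q)$ consisting of those $\eta$ with $\eta(x)=\eta(y)$ (so $\mathrm{Bd}\,\mathrm{Hom}(P-x,Q)$ is viewed as a subcomplex of $\mathrm{Bd}\,\mathrm{Hom}(P,Q)$). -}

module Defs where

open import Data.Nat using (ℕ; suc; _∸_)
open import Data.Fin using (Fin)
open import Data.Fin.Subset using (Subset; _∈_; _∉_; _⊆_; ∣_∣; Nonempty)
open import Data.Vec using (Vec; lookup; map; sum)
open import Data.List using (List; []; length)
open import Data.List.Relation.Unary.All using (All)
open import Data.List.Relation.Unary.Linked using (Linked)
import Data.List.Relation.Binary.Sublist.Propositional as SL
open import Data.Product using (Σ; ∃; _×_)
open import Data.Sum using (_⊎_)
open import Relation.Binary.Structures using (IsPartialOrder)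
open import Relation.Binary.Definitions using (Decidable)
open import Relation.Binary.PropositionalEquality using (_≡_; _≢_)
open import Relation.Nullary using (¬_)
open import Function.Bundles using (_⇔_)

record FinPoset : Set₁ where
  field
    size  : ℕ
    _≤_   : Fin size → Fin size → Set
    isPO  : IsPartialOrder _≡_ _≤_
    _≤?_  : Decidable _≤_

open FinPoset public

Lt : (P : FinPoset) → Fin (size P) → Fin (size P) → Set
Lt P a b = _≤_ P a b × a ≢ b

Covers : (P : FinPoset) → Fin (size P) → Fin (size P) → Set
Covers P a b = Lt P a b × ¬ (∃ λ c → Lt P a c × Lt P c b)

-- Abstract (polyhedral / simplicial) complexes given as a subset K of an
-- ambient type C of cells, with face relation _≼_ and dimension dim.

module _ {C : Set} (_≼_ : C → C → Set) (dim : C → ℕ) where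

  record ElemCollapse (K K' : C → Set) : Set where
    field
      σ τ    : C
      σ∈K    : K σ
      τ∈K    : K τ
      σ≼τ    : σ ≼ τ
      dimτ   : dim τ ≡ suc (dim σ)
      free   : ∀ ρ → K ρ → σ ≼ ρ → ρ ≡ σ ⊎ ρ ≡ τ
      result : ∀ ρ → K' ρ ⇔ (K ρ × ρ ≢ σ × ρ ≢ τ)

  data Collapses : (C → Set) → (C → Set) → Set₁ where
    done : ∀ {K L} → (∀ c → K c ⇔ L c) → Collapses K L
    step : ∀ {K K' L} → ElemCollapse K K' → Collapses K' L → Collapses K L

-- Poset homomorphism complex Hom(A,B): a cell is a tuple (X_a)_{a∈A}
-- of subsets of B (a Vec indexed by A), with every X_a nonempty and
-- every selection η strictly order preserving.

Cell : FinPoset → FinPoset → Set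
Cell A B = Vec (Subset (size B)) (size A)

HomCell : (A B : FinPoset) → Cell A B → Set
HomCell A B X =
  (∀ a → Nonempty (lookup X a)) ×
  ((η : Fin (size A) → Fin (size B)) → (∀ a → η a ∈ lookup X a) →
     ∀ a a' → Lt A a a' → Lt B (η a) (η a'))

-- face order of cells and dimension (product of simplices)
_⊑_ : {A B : FinPoset} → Cell A B → Cell A B → Set
_⊑_ {A} {B} X Y = ∀ a → lookup X a ⊆ lookup Y a

cellDim : {A B : FinPoset} → Cell A B → ℕ
cellDim {A} {B} X = sum (map (λ (s : Subset (size B)) → ∣ s ∣ ∸ 1) X)

HomCx : (A B : FinPoset) → Cell A B → Set
HomCx A B = HomCell A B

-- Hom(A, B - z): cells of Hom(A,B) not using z
HomAvoid : (A B : FinPoset) → Fin (size B) → Cell A B → Set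
HomAvoid A B z X = HomCell A B X × (∀ a → z ∉ lookup X a)

-- Barycentric subdivision: simplices are nonempty chains of cells,
-- represented canonically as strictly increasing lists; faces are
-- sublists; dimension = length - 1.

_⊏_ : {A B : FinPoset} → Cell A B → Cell A B → Set
_⊏_ {A} {B} X Y = _⊑_ {A} {B} X Y × X ≢ Y

BdSimplex : (A B : FinPoset) → (Cell A B → Set) → List (Cell A B) → Set
BdSimplex A B K s = s ≢ [] × All K s × Linked (_⊏_ {A} {B}) s

chainDim : {A B : FinPoset} → List (Cell A B) → ℕ
chainDim s = length s ∸ 1

_⊆ˡ_ : {A B : FinPoset} → List (Cell A B) → List (Cell A B) → Set
s ⊆ˡ t = s SL.⊆ t

BdHom : (A B : FinPoset) → List (Cell A B) → Set
BdHom A B = BdSimplex A B (HomCell A B)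

-- Bd Hom(A - x, B), identified with chains of cells η of Hom(A,B)
-- with η(x) = η(y)
BdHomFold : (A B : FinPoset) → Fin (size A) → Fin (size A) →
            List (Cell A B) → Set
BdHomFold A B x y =
  BdSimplex A B (λ X → HomCell A B X × lookup X x ≡ lookup X y)

module Submission where

-- If y ≠ x witnesses that P - x is a fold of P, then y has exactly the strict
-- comparabilities of x (Fold).  Both collapses come from a discrete Morse
-- criterion (MatchingCollapse): if the cells of K outside L are paired off as
-- (σ , τ), σ a facet of τ, so that every other cell above a lower cell σ lies
-- in a pair of larger rank, then K collapses onto L.
-- * Hom(Q,P) ↘ Hom(Q,P-x) (HomFold): a cell using x is paired with the cell
--   obtained by toggling y in its first entry containing x.
-- * Bd Hom(P,Q) ↘ Bd Hom(P-x,Q) (BdFold): an order complex collapses onto the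
--   order complex of the image of an upper closure (ClosureCollapse).  The
--   closure X ↦ X[x := X_x ∪ X_y] reaches the cells with X_y ⊆ X_x; then
--   X ↦ X[x := X_y], an upper closure for the opposite order (transported
--   along list reversal), reaches the cells with X_x = X_y.

open import Defs hiding (_≤_)
open import Level using (0ℓ)
open import Data.Nat using (ℕ; zero; suc; _+_; _*_; _∸_; _<_; _≤_; z≤n; s≤s)
import Data.Nat.Properties as ℕ
open import Data.Bool using (true; false; not)
import Data.Bool
import Data.Bool.Properties as Bool
open import Data.Empty using (⊥-elim)
open import Data.Unit using (⊤; tt)
open import Data.Product using (Σ; _×_; _,_; proj₁; proj₂)
open import Data.Product.Relation.Binary.Lex.Strict using (×-strictTotalOrder)
open import Data.Sum using (_⊎_; inj₁; inj₂)
import Data.Sum as Sum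
open import Data.Maybe using (Maybe; just; nothing)
import Data.Maybe as Maybe
import Data.Maybe.Properties as Maybe
open import Data.Fin using (Fin; zero; suc; toℕ)
import Data.Fin.Properties as Fin
open import Data.Fin.Induction using (po-wellFounded; po-noetherian)
open import Data.Fin.Subset using (Subset; _∈_; _⊆_; ∣_∣; Nonempty; _∪_; inside; outside)
import Data.Fin.Subset.Properties as Subset
open import Data.Vec using (Vec; []; _∷_; lookup; _[_]≔_)
import Data.Vec.Properties as Vec
open import Data.List using (List; []; _∷_; _++_; [_]; length; filter; concatMap; map; reverse)
import Data.List.Properties as List
open import Data.List.Membership.Propositional using () renaming (_∈_ to _∈ˡ_; _∉_ to _∉ˡ_)
import Data.List.Membership.Propositional.Properties as Membership
open import Data.List.Relation.Unary.Any using (here; there)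
import Data.List.Relation.Unary.Any as Any
import Data.List.Relation.Unary.Any.Properties as Any
open import Data.List.Relation.Unary.All as All using (All; []; _∷_)
import Data.List.Relation.Unary.All.Properties as All
open import Data.List.Relation.Unary.Linked as Linked using (Linked; []; [-]; _∷_)
import Data.List.Relation.Binary.Sublist.Propositional as SL
import Data.List.Relation.Binary.Sublist.Propositional.Properties as SL
import Data.List.Relation.Binary.Sublist.Heterogeneous.Properties as SLʰ
import Data.List.Relation.Binary.Pointwise as Pointwise
open import Function.Base using (_∘_; flip; id)
open import Function.Bundles using (_⇔_; mk⇔; Equivalence)
open import Induction.WellFounded using (Acc; acc)
open import Relation.Binary.Bundles using (StrictTotalOrder)
open import Relation.Binary.Definitions using (DecidableEquality)
open import Relation.Binary.Structures using (IsPartialOrder)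
open import Relation.Binary.PropositionalEquality
  using (_≡_; _≢_; refl; sym; trans; cong; cong₂; subst; subst₂; module ≡-Reasoning)
open import Relation.Nullary using (¬_; Dec; yes; no)
open import Relation.Nullary.Decidable using (_×-dec_; ¬?; _→-dec_)

module CollapseCalculus {C : Set} (_≼_ : C → C → Set) (dim : C → ℕ) where

  open Equivalence

  collapse-respˡ : ∀ {K K' L} → (∀ c → K c ⇔ K' c) →
                   Collapses _≼_ dim K L → Collapses _≼_ dim K' L
  collapse-respˡ K⇔K' (done K⇔L) =
    done λ c → mk⇔ (to (K⇔L c) ∘ from (K⇔K' c)) (to (K⇔K' c) ∘ from (K⇔L c))
  collapse-respˡ {K} {K'} K⇔K' (step {K' = K₁} e rest) = step e' rest
    where
    open ElemCollapse e
    e' : ElemCollapse _≼_ dim K' K₁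
    e' = record
      { σ = σ ; τ = τ ; σ∈K = to (K⇔K' σ) σ∈K ; τ∈K = to (K⇔K' τ) τ∈K
      ; σ≼τ = σ≼τ ; dimτ = dimτ
      ; free = λ ρ k → free ρ (from (K⇔K' ρ) k)
      ; result = λ ρ → mk⇔
          (λ k → let (k₀ , ≢σ , ≢τ) = to (result ρ) k in to (K⇔K' ρ) k₀ , ≢σ , ≢τ)
          (λ (k₀ , ≢σ , ≢τ) → from (result ρ) (from (K⇔K' ρ) k₀ , ≢σ , ≢τ)) }

  collapse-respʳ : ∀ {K L L'} → (∀ c → L c ⇔ L' c) →
                   Collapses _≼_ dim K L → Collapses _≼_ dim K L'
  collapse-respʳ L⇔L' (done K⇔L) =
    done λ c → mk⇔ (to (L⇔L' c) ∘ to (K⇔L c)) (from (K⇔L c) ∘ from (L⇔L' c))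
  collapse-respʳ L⇔L' (step e rest) = step e (collapse-respʳ L⇔L' rest)

  collapse-trans : ∀ {K L M} → Collapses _≼_ dim K L → Collapses _≼_ dim L M →
                   Collapses _≼_ dim K M
  collapse-trans (done K⇔L) L↘M =
    collapse-respˡ (λ c → mk⇔ (from (K⇔L c)) (to (K⇔L c))) L↘M
  collapse-trans (step e rest) L↘M = step e (collapse-trans rest L↘M)

  collapse-transport : (f : C → C) → (∀ c → f (f c) ≡ c) →
                       (∀ {a b} → a ≼ b → f a ≼ f b) → (∀ c → dim (f c) ≡ dim c) →
                       ∀ {K L} → Collapses _≼_ dim K L →
                       Collapses _≼_ dim (K ∘ f) (L ∘ f)
  collapse-transport f ff f≼ fdim (done K⇔L) = done λ c → K⇔L (f c)
  collapse-transport f ff f≼ fdim {K} (step {K' = K₁} e rest) =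
    step e' (collapse-transport f ff f≼ fdim rest)
    where
    open ElemCollapse e
    back : ∀ {ρ c} → f ρ ≡ c → ρ ≡ f c
    back {ρ} e = trans (sym (ff ρ)) (cong f e)
    forth : ∀ {ρ c} → ρ ≡ f c → f ρ ≡ c
    forth {c = c} e = trans (cong f e) (ff c)
    e' : ElemCollapse _≼_ dim (K ∘ f) (K₁ ∘ f)
    e' = record
      { σ = f σ ; τ = f τ
      ; σ∈K = subst K (sym (ff σ)) σ∈K ; τ∈K = subst K (sym (ff τ)) τ∈K
      ; σ≼τ = f≼ σ≼τ
      ; dimτ = trans (fdim τ) (trans dimτ (cong suc (sym (fdim σ))))
      ; free = λ ρ k σρ →
          Sum.map back back (free (f ρ) k (subst (_≼ f ρ) (ff σ) (f≼ σρ)))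
      ; result = λ ρ → mk⇔
          (λ k → let (k₀ , ≢σ , ≢τ) = to (result (f ρ)) k in
                 k₀ , ≢σ ∘ forth , ≢τ ∘ forth)
          (λ (k₀ , ≢σ , ≢τ) → from (result (f ρ)) (k₀ , ≢σ ∘ back , ≢τ ∘ back)) }

module Maximum (O : StrictTotalOrder 0ℓ 0ℓ 0ℓ) {C : Set}
               (rank : C → StrictTotalOrder.Carrier O) where
  open StrictTotalOrder O using (irrefl; module Eq)
    renaming (_<_ to _≺_; _<?_ to _≺?_; trans to ≺-trans)

  Maximal : C → List C → Set
  Maximal m R = ∀ s → s ∈ˡ R → ¬ (rank m ≺ rank s)

  maximum : (z : C) (R : List C) → Σ C λ m → m ∈ˡ z ∷ R × Maximal m (z ∷ R)
  maximum z [] = z , here refl , λ { _ (here refl) → irrefl Eq.refl }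
  maximum z (w ∷ R) with maximum z R
  ... | m , m∈ , m-max with rank m ≺? rank w
  ...   | no m≮w = m , shift m∈ , λ
      { _ (here refl) → m-max z (here refl)
      ; _ (there (here refl)) → m≮w
      ; s (there (there s∈)) → m-max s (there s∈) }
    where
    shift : ∀ {m} → m ∈ˡ z ∷ R → m ∈ˡ z ∷ w ∷ R
    shift (here e) = here e
    shift (there p) = there (there p)
  ...   | yes m<w = w , there (here refl) , λ
      { _ (here refl) w<z → m-max z (here refl) (≺-trans m<w w<z)
      ; _ (there (here refl)) → irrefl Eq.refl
      ; s (there (there s∈)) w<s → m-max s (there s∈) (≺-trans m<w w<s) }

module MatchingCollapse {C : Set} (_≟_ : DecidableEquality C)
                        (_≼_ : C → C → Set) (dim : C → ℕ)
                        (O : StrictTotalOrder 0ℓ 0ℓ 0ℓ) where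
  open StrictTotalOrder O using () renaming (Carrier to Rank; _<_ to _≺_)
  open CollapseCalculus _≼_ dim

  record AcyclicMatching (K L : C → Set) : Set₁ where
    field
      L⊆K             : ∀ {c} → L c → K c
      Lower           : C → Set
      mate            : C → C
      rank            : C → Rank
      lower∈K         : ∀ {σ} → Lower σ → K σ
      lower∉L         : ∀ {σ} → Lower σ → ¬ L σ
      mate∈K          : ∀ {σ} → Lower σ → K (mate σ)
      mate∉L          : ∀ {σ} → Lower σ → ¬ L (mate σ)
      mate-not-lower  : ∀ {σ} → Lower σ → ¬ Lower (mate σ)
      mate-involutive : ∀ {σ} → Lower σ → mate (mate σ) ≡ σ
      lower≼mate      : ∀ {σ} → Lower σ → σ ≼ mate σ
      dim-mate        : ∀ {σ} → Lower σ → dim (mate σ) ≡ suc (dim σ)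
      acyclic         : ∀ {σ ρ} → Lower σ → K ρ → σ ≼ ρ → ρ ≢ σ → ρ ≢ mate σ →
                        Σ C λ s → Lower s × (ρ ≡ s ⊎ ρ ≡ mate s) × rank σ ≺ rank s
      lowers          : List C
      lowers-lower    : All Lower lowers
      covering        : ∀ c → K c →
                        L c ⊎ Σ C λ s → s ∈ˡ lowers × (c ≡ s ⊎ c ≡ mate s)

  module _ {K L : C → Set} (M : AcyclicMatching K L) where
    open AcyclicMatching M
    open Maximum O rank

    InPair : C → C → Set
    InPair s c = c ≡ s ⊎ c ≡ mate s

    Remaining : List C → C → Set
    Remaining R c = K c × (L c ⊎ Σ C λ s → s ∈ˡ R × InPair s c)

    pair-unique : ∀ {s t c} → Lower s → Lower t → InPair s c → InPair t c → s ≡ t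
    pair-unique ls lt (inj₁ refl) (inj₁ refl) = refl
    pair-unique ls lt (inj₁ refl) (inj₂ refl) = ⊥-elim (mate-not-lower lt ls)
    pair-unique ls lt (inj₂ refl) (inj₁ e) = ⊥-elim (mate-not-lower ls (subst Lower (sym e) lt))
    pair-unique ls lt (inj₂ refl) (inj₂ e) =
      trans (sym (mate-involutive ls)) (trans (cong mate e) (mate-involutive lt))

    without : C → List C → List C
    without σ = filter (λ s → ¬? (s ≟ σ))

    -- The lower cell of maximal rank is a free face of its mate: anything else
    -- above it would lie in a pair of larger rank.
    maximal-free : ∀ {R σ} → All Lower R → Lower σ → Maximal σ R →
                   ∀ ρ → Remaining R ρ → σ ≼ ρ → ρ ≡ σ ⊎ ρ ≡ mate σ
    maximal-free {R} {σ} lowR lσ σ-max ρ (kρ , rest) σ≼ρ with ρ ≟ σ | ρ ≟ mate σ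
    ... | yes e | _ = inj₁ e
    ... | no _ | yes e = inj₂ e
    ... | no ρ≢σ | no ρ≢τ with acyclic lσ kρ σ≼ρ ρ≢σ ρ≢τ | rest
    ...   | s , ls , ρ∈s , _ | inj₁ lρ =
      ⊥-elim (Sum.[ (λ { refl → lower∉L ls lρ }) , (λ { refl → mate∉L ls lρ }) ] ρ∈s)
    ...   | s , ls , ρ∈s , σ≺s | inj₂ (s' , s'∈R , ρ∈s') =
      ⊥-elim (σ-max s' s'∈R (subst (λ t → rank σ ≺ rank t)
                                   (pair-unique ls (All.lookup lowR s'∈R) ρ∈s ρ∈s') σ≺s))

    remove-pair : ∀ {R σ} → All Lower R → Lower σ → σ ∈ˡ R → ∀ ρ →
                  Remaining (without σ R) ρ ⇔ (Remaining R ρ × ρ ≢ σ × ρ ≢ mate σ)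
    remove-pair {R} {σ} lowR lσ σ∈R ρ = mk⇔ to from
      where
      to : Remaining (without σ R) ρ → Remaining R ρ × ρ ≢ σ × ρ ≢ mate σ
      to (k , inj₁ l) = (k , inj₁ l) , (λ { refl → lower∉L lσ l }) , (λ { refl → mate∉L lσ l })
      to (k , inj₂ (s , s∈ , ρ∈s)) with Membership.∈-filter⁻ (λ s → ¬? (s ≟ σ)) {xs = R} s∈
      ... | s∈R , s≢σ = (k , inj₂ (s , s∈R , ρ∈s)) ,
        (λ { refl → s≢σ (pair-unique (All.lookup lowR s∈R) lσ ρ∈s (inj₁ refl)) }) ,
        (λ { refl → s≢σ (pair-unique (All.lookup lowR s∈R) lσ ρ∈s (inj₂ refl)) })
      from : Remaining R ρ × ρ ≢ σ × ρ ≢ mate σ → Remaining (without σ R) ρ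
      from ((k , inj₁ l) , _) = k , inj₁ l
      from ((k , inj₂ (s , s∈ , ρ∈s)) , ρ≢σ , ρ≢τ) with s ≟ σ
      ... | yes refl = ⊥-elim (Sum.[ ρ≢σ , ρ≢τ ] ρ∈s)
      ... | no s≢σ = k , inj₂ (s , Membership.∈-filter⁺ (λ s → ¬? (s ≟ σ)) s∈ s≢σ , ρ∈s)

    remove-maximal : ∀ {R σ} → All Lower R → σ ∈ˡ R → Maximal σ R →
                     ElemCollapse _≼_ dim (Remaining R) (Remaining (without σ R))
    remove-maximal {σ = σ} lowR σ∈R σ-max = record
      { σ = σ ; τ = mate σ
      ; σ∈K = lower∈K lσ , inj₂ (_ , σ∈R , inj₁ refl)
      ; τ∈K = mate∈K lσ , inj₂ (_ , σ∈R , inj₂ refl)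
      ; σ≼τ = lower≼mate lσ
      ; dimτ = dim-mate lσ
      ; free = maximal-free lowR lσ σ-max
      ; result = remove-pair lowR lσ σ∈R }
      where
      lσ : Lower σ
      lσ = All.lookup lowR σ∈R

    -- Removing maximal pairs one at a time (n bounds the number of pairs).
    collapse-remaining : (n : ℕ) (R : List C) → length R < n → All Lower R →
                         Collapses _≼_ dim (Remaining R) L
    collapse-remaining n [] _ _ =
      done λ c → mk⇔ (λ { (_ , inj₁ l) → l ; (_ , inj₂ (_ , () , _)) }) (λ l → L⊆K l , inj₁ l)
    collapse-remaining (suc n) (z ∷ R) (s≤s |R|<n) lowR with maximum z R
    ... | σ , σ∈ , σ-max =
      step (remove-maximal lowR σ∈ σ-max)
           (collapse-remaining n (without σ (z ∷ R)) shorter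
                               (All.filter⁺ (λ s → ¬? (s ≟ σ)) lowR))
      where
      shorter : length (without σ (z ∷ R)) < n
      shorter = ℕ.<-≤-trans (List.filter-notAll (λ s → ¬? (s ≟ σ)) (z ∷ R)
                                (Any.map (λ { refl s≢s → s≢s refl }) σ∈)) |R|<n

    matching-collapse : Collapses _≼_ dim K L
    matching-collapse =
      collapse-respˡ (λ c → mk⇔ (λ (k , _) → k) (λ k → k , covering c k))
        (collapse-remaining (suc (length lowers)) lowers ℕ.≤-refl lowers-lower)

ℕ²-lex : StrictTotalOrder 0ℓ 0ℓ 0ℓ
ℕ²-lex = ×-strictTotalOrder ℕ.<-strictTotalOrder ℕ.<-strictTotalOrder

open StrictTotalOrder ℕ²-lex using () renaming (_<_ to _≺_)

≺-from-≤-< : ∀ {d d' k k'} → d ≤ d' → k < k' → (d , k) ≺ (d' , k')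
≺-from-≤-< d≤d' k<k' with ℕ.m≤n⇒m<n∨m≡n d≤d'
... | inj₁ d<d' = inj₁ d<d'
... | inj₂ d≡d' = inj₂ (d≡d' , k<k')

module ListFacts {A : Set} where

  sublist-shorter : ∀ {xs ys : List A} → xs SL.⊆ ys → xs ≢ ys → length xs < length ys
  sublist-shorter p xs≢ys with ℕ.m≤n⇒m<n∨m≡n (SL.length-mono-≤ p)
  ... | inj₁ lt = lt
  ... | inj₂ e = ⊥-elim (xs≢ys (Pointwise.Pointwise-≡⇒≡ (SLʰ.toPointwise e p)))

  sublist-delete : ∀ {xs : List A} us {z vs} → xs SL.⊆ (us ++ z ∷ vs) → z ∉ˡ xs →
                   xs SL.⊆ (us ++ vs)
  sublist-delete [] (_ SL.∷ʳ p) z∉ = p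
  sublist-delete [] (refl SL.∷ p) z∉ = ⊥-elim (z∉ (here refl))
  sublist-delete (u ∷ us) (_ SL.∷ʳ p) z∉ = u SL.∷ʳ sublist-delete us p z∉
  sublist-delete (u ∷ us) (refl SL.∷ p) z∉ = refl SL.∷ sublist-delete us p (z∉ ∘ there)

  length-insert : ∀ (us : List A) z vs → length (us ++ z ∷ vs) ≡ suc (length (us ++ vs))
  length-insert [] z vs = refl
  length-insert (u ∷ us) z vs = cong suc (length-insert us z vs)

  ++-∷-nonempty : ∀ (us : List A) {z vs} → us ++ z ∷ vs ≢ []
  ++-∷-nonempty [] ()
  ++-∷-nonempty (u ∷ us) ()

  module Increasing (R : A → A → Set) (R-trans : ∀ {a b c} → R a b → R b c → R a c) where

    linked-after : ∀ {z ys w} → Linked R (z ∷ ys) → w ∈ˡ ys → R z w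
    linked-after (r ∷ l) (here refl) = r
    linked-after (r ∷ l) (there m) = R-trans r (linked-after l m)

    linked-suffix : ∀ xs {z ys} → Linked R (xs ++ z ∷ ys) → Linked R (z ∷ ys)
    linked-suffix [] l = l
    linked-suffix (x ∷ xs) l = linked-suffix xs (Linked.tail l)

    linked-before : ∀ xs {z ys w} → Linked R (xs ++ z ∷ ys) → w ∈ˡ xs → R w z
    linked-before (x ∷ xs) {z} l (here refl) =
      linked-after {ys = xs ++ z ∷ _} l (Membership.∈-++⁺ʳ xs (here refl))
    linked-before (x ∷ xs) l (there m) = linked-before xs (Linked.tail l) m

    linked-insert : ∀ xs {p z ys} → Linked R (xs ++ p ∷ ys) → R p z →
                    (∀ {q r} → ys ≡ q ∷ r → R z q) → Linked R (xs ++ p ∷ z ∷ ys)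
    linked-insert [] {ys = []} l pz zq = pz ∷ [-]
    linked-insert [] {ys = q ∷ r} (_ ∷ l) pz zq = pz ∷ zq refl ∷ l
    linked-insert (x ∷ []) (r ∷ l) pz zq = r ∷ linked-insert [] l pz zq
    linked-insert (x ∷ x' ∷ xs) (r ∷ l) pz zq = r ∷ linked-insert (x' ∷ xs) l pz zq

    linked-delete : ∀ xs {p z ys} → Linked R (xs ++ p ∷ z ∷ ys) → Linked R (xs ++ p ∷ ys)
    linked-delete [] {ys = []} (r ∷ l) = [-]
    linked-delete [] {ys = q ∷ ys} (r ∷ r' ∷ l) = R-trans r r' ∷ l
    linked-delete (x ∷ []) (r ∷ l) = r ∷ linked-delete [] l
    linked-delete (x ∷ x' ∷ xs) (r ∷ l) = r ∷ linked-delete (x' ∷ xs) l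

  module Reverse (R : A → A → Set) (R-trans : ∀ {a b c} → R a b → R b c → R a c) where
    open Increasing (flip R) (λ ba cb → R-trans cb ba)

    all-reverse : ∀ {P : A → Set} {xs} → All P xs → All P (reverse xs)
    all-reverse P-xs = All.tabulate λ x∈ → All.lookup P-xs (Any.reverse⁻ x∈)

    linked-reverse : ∀ {xs} → Linked R xs → Linked (flip R) (reverse xs)
    linked-reverse [] = []
    linked-reverse [-] = [-]
    linked-reverse {a ∷ b ∷ S} (a⊏b ∷ l) =
      subst (Linked (flip R)) (sym reverse-a∷b∷S)
            (linked-insert (reverse S) {ys = []}
               (subst (Linked (flip R)) (List.unfold-reverse b S) (linked-reverse l)) a⊏b (λ ()))
      where
      reverse-a∷b∷S : reverse (a ∷ b ∷ S) ≡ reverse S ++ b ∷ a ∷ []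
      reverse-a∷b∷S = trans (List.unfold-reverse a (b ∷ S))
                       (trans (cong (_++ [ a ]) (List.unfold-reverse b S)) (List.++-assoc (reverse S) [ b ] [ a ]))

-- Collapsing an order complex onto the order complex of the image of an upper
-- closure: the combinatorial core of Quillen's fiber lemma for closures.
module ClosureCollapse {C : Set} (_≟_ : DecidableEquality C)
  (_⊏_ : C → C → Set) (⊏-trans : ∀ {a b d} → a ⊏ b → b ⊏ d → a ⊏ d)
  (⊏-irrefl : ∀ {a} → ¬ a ⊏ a) (_⊏?_ : ∀ a b → Dec (a ⊏ b)) where

  open ListFacts
  open Increasing _⊏_ ⊏-trans

  Chain : (C → Set) → List C → Set
  Chain K S = S ≢ [] × All K S × Linked _⊏_ S

  -- F ⊆ K is the image of an upper closure: every p ∈ K ∖ F lies strictly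
  -- below a least element `closure p` of F.  The height function and the
  -- list of cells witness finiteness of K.
  record UpperClosure (K F : C → Set) : Set where
    field
      K?             : ∀ a → Dec (K a)
      F?             : ∀ a → Dec (F a)
      closure        : C → C
      closure∈K      : ∀ {p} → K p → K (closure p)
      closure∈F      : ∀ {p} → K p → F (closure p)
      below-closure  : ∀ {p} → K p → ¬ F p → p ⊏ closure p
      closure-least  : ∀ {p q} → K p → ¬ F p → K q → F q → p ⊏ q →
                       closure p ≡ q ⊎ closure p ⊏ q
      height         : C → ℕ
      height-mono    : ∀ {a b} → K a → K b → a ⊏ b → height a < height b
      maxHeight      : ℕ
      height≤max     : ∀ {p} → K p → height p ≤ maxHeight
      cells          : List C
      cells-complete : ∀ {p} → K p → p ∈ˡ cells

  module _ {K F : C → Set} (U : UpperClosure K F) where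
    open UpperClosure U

    Inside : List C → Set
    Inside = Chain (λ p → K p × F p)

    data PivotView (S : List C) : Set where
      inside : All F S → PivotView S
      pivot  : ∀ pre p post → S ≡ pre ++ p ∷ post → ¬ F p → All F post → PivotView S

    pivotView : ∀ S → PivotView S
    pivotView [] = inside []
    pivotView (a ∷ t) with pivotView t
    ... | pivot pre p post e p∉F post⊆F = pivot (a ∷ pre) p post (cong (a ∷_) e) p∉F post⊆F
    ... | inside t⊆F with F? a
    ...   | yes a∈F = inside (a∈F ∷ t⊆F)
    ...   | no a∉F = pivot [] a t refl a∉F t⊆F

    -- The same split, computed as a function (so that it is unique).
    Split : Set
    Split = List C × C × List C

    lastOutside : List C → Maybe Split
    lastOutside [] = nothing
    lastOutside (a ∷ t) with lastOutside t
    ... | just (pre , p , post) = just (a ∷ pre , p , post)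
    ... | nothing with F? a
    ...   | yes _ = nothing
    ...   | no _ = just ([] , a , t)

    lastOutside-inside : ∀ {S} → All F S → lastOutside S ≡ nothing
    lastOutside-inside [] = refl
    lastOutside-inside {a ∷ t} (a∈F ∷ t⊆F) rewrite lastOutside-inside t⊆F with F? a
    ... | yes _ = refl
    ... | no a∉F = ⊥-elim (a∉F a∈F)

    lastOutside-pivot : ∀ pre {p post} → ¬ F p → All F post →
                        lastOutside (pre ++ p ∷ post) ≡ just (pre , p , post)
    lastOutside-pivot [] {p} p∉F post⊆F rewrite lastOutside-inside post⊆F with F? p
    ... | yes p∈F = ⊥-elim (p∉F p∈F)
    ... | no _ = refl
    lastOutside-pivot (a ∷ pre) p∉F post⊆F rewrite lastOutside-pivot pre p∉F post⊆F = refl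

    pivot-unique : ∀ pre p post pre' p' post' → pre ++ p ∷ post ≡ pre' ++ p' ∷ post' →
                   ¬ F p → All F post → ¬ F p' → All F post' →
                   (pre , p , post) ≡ (pre' , p' , post')
    pivot-unique pre p post pre' p' post' e p∉F post⊆F p'∉F post'⊆F = Maybe.just-injective
      (trans (sym (lastOutside-pivot pre p∉F post⊆F))
             (trans (cong lastOutside e) (lastOutside-pivot pre' p'∉F post'⊆F)))

    -- The matching toggles `closure p` just after the pivot p.
    toggleAfter : C → List C → List C
    toggleAfter p [] = closure p ∷ []
    toggleAfter p (q ∷ r) with q ≟ closure p
    ... | yes _ = r
    ... | no _ = closure p ∷ q ∷ r

    mateOf : Maybe Split → List C → List C
    mateOf (just (pre , p , post)) S = pre ++ p ∷ toggleAfter p post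
    mateOf nothing S = S

    mate : List C → List C
    mate S = mateOf (lastOutside S) S

    rankOf : Maybe Split → List C → ℕ × ℕ
    rankOf (just (pre , p , post)) S = height p , length S
    rankOf nothing S = 0 , 0

    rank : List C → ℕ × ℕ
    rank S = rankOf (lastOutside S) S

    NotHead : C → List C → Set
    NotHead z [] = ⊤
    NotHead z (q ∷ r) = q ≢ z

    record Lower (S : List C) : Set where
      constructor lower
      field
        chain    : Chain K S
        pre      : List C
        p        : C
        post     : List C
        split    : S ≡ pre ++ p ∷ post
        p∉F      : ¬ F p
        post⊆F   : All F post
        not-next : NotHead (closure p) post
    open Lower

    toggle-absent : ∀ p post → NotHead (closure p) post → toggleAfter p post ≡ closure p ∷ post
    toggle-absent p [] _ = refl
    toggle-absent p (q ∷ r) q≢ with q ≟ closure p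
    ... | yes e = ⊥-elim (q≢ e)
    ... | no _ = refl

    toggle-present : ∀ p post → toggleAfter p (closure p ∷ post) ≡ post
    toggle-present p post with closure p ≟ closure p
    ... | yes _ = refl
    ... | no n = ⊥-elim (n refl)

    rank-pivot : ∀ pre {p post} → ¬ F p → All F post →
                 rank (pre ++ p ∷ post) ≡ (height p , length (pre ++ p ∷ post))
    rank-pivot pre p∉F post⊆F rewrite lastOutside-pivot pre p∉F post⊆F = refl

    mate-pivot : ∀ pre {p post} → ¬ F p → All F post →
                 mate (pre ++ p ∷ post) ≡ pre ++ p ∷ toggleAfter p post
    mate-pivot pre p∉F post⊆F rewrite lastOutside-pivot pre p∉F post⊆F = refl

    mate-lower : ∀ {S} (l : Lower S) → mate S ≡ pre l ++ p l ∷ closure (p l) ∷ post l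
    mate-lower (lower _ pre p post refl p∉F post⊆F not-next) =
      trans (mate-pivot pre p∉F post⊆F) (cong (λ t → pre ++ p ∷ t) (toggle-absent p post not-next))

    chain-member : ∀ {S} → Chain K S → ∀ {z} → z ∈ˡ S → K z
    chain-member (_ , S⊆K , _) = All.lookup S⊆K

    pivot∈K : ∀ {S} (l : Lower S) → K (p l)
    pivot∈K (lower c pre p post refl _ _ _) = chain-member c (Membership.∈-++⁺ʳ pre (here refl))

    -- Everything after the pivot lies in F above it, hence above its closure.
    closure-below-post : ∀ {S} (l : Lower S) → ∀ {z} → z ∈ˡ post l → closure (p l) ⊏ z
    closure-below-post l@(lower c@(_ , _ , increasing) pre p (q ∷ r) refl p∉F post⊆F q≢)
                       {z} z∈
      with closure-least (pivot∈K l) p∉F (chain-member c (Membership.∈-++⁺ʳ pre (there (here refl))))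
                         (All.head post⊆F) (linked-after (linked-suffix pre increasing) (here refl))
    ... | inj₁ e = ⊥-elim (q≢ (sym e))
    ... | inj₂ cp⊏q with z∈
    ...   | here refl = cp⊏q
    ...   | there z∈r = ⊏-trans cp⊏q (linked-after (Linked.tail (linked-suffix pre increasing)) z∈r)

    mate∈K : ∀ {S} → Lower S → Chain K (mate S)
    mate∈K l@(lower (_ , S⊆K , increasing) pre p post refl p∉F _ _) rewrite mate-lower l =
      ++-∷-nonempty pre ,
      All.++⁺ (All.++⁻ˡ pre S⊆K)
              (pivot∈K l ∷ closure∈K (pivot∈K l) ∷ All.tail (All.++⁻ʳ pre S⊆K)) ,
      linked-insert pre increasing (below-closure (pivot∈K l) p∉F)
                    (λ { refl → closure-below-post l (here refl) })

    lower∉Inside : ∀ {S} → Lower S → ¬ Inside S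
    lower∉Inside (lower _ pre p post refl p∉F _ _) (_ , S⊆KF , _) =
      p∉F (proj₂ (All.lookup S⊆KF (Membership.∈-++⁺ʳ pre (here refl))))

    mate∉Inside : ∀ {S} → Lower S → ¬ Inside (mate S)
    mate∉Inside l@(lower _ pre p post refl p∉F _ _) (_ , S⊆KF , _) rewrite mate-lower l =
      p∉F (proj₂ (All.lookup S⊆KF (Membership.∈-++⁺ʳ pre (here refl))))

    mate-not-lower : ∀ {S} → Lower S → ¬ Lower (mate S)
    mate-not-lower l@(lower _ pre p post refl p∉F post⊆F _)
                     (lower _ pre' p' post' e' p'∉F post'⊆F not-next')
      with pivot-unique pre p (closure p ∷ post) pre' p' post' (trans (sym (mate-lower l)) e')
                        p∉F (closure∈F (pivot∈K l) ∷ post⊆F) p'∉F post'⊆F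
    ... | refl = not-next' refl

    mate-involutive : ∀ {S} → Lower S → mate (mate S) ≡ S
    mate-involutive l@(lower _ pre p post refl p∉F post⊆F _) rewrite mate-lower l =
      trans (mate-pivot pre p∉F (closure∈F (pivot∈K l) ∷ post⊆F))
            (cong (λ t → pre ++ p ∷ t) (toggle-present p post))

    lower⊆mate : ∀ {S} → Lower S → S SL.⊆ mate S
    lower⊆mate l@(lower _ pre p post refl _ _ _) rewrite mate-lower l =
      SL.++⁺ SL.⊆-refl (refl SL.∷ (closure p SL.∷ʳ SL.⊆-refl))

    dim-mate : ∀ {S} → Lower S → length (mate S) ∸ 1 ≡ suc (length S ∸ 1)
    dim-mate l@(lower _ pre p post refl _ _ _)
      rewrite mate-lower l | length-insert pre p (closure p ∷ post)
            | length-insert pre (closure p) post | length-insert pre p post = refl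

    linked-not-head : ∀ {z r} → Linked _⊏_ (z ∷ r) → NotHead z r
    linked-not-head {r = []} _ = tt
    linked-not-head {r = q ∷ r} (z⊏q ∷ _) = λ { refl → ⊏-irrefl z⊏q }

    pair-of : ∀ {ρ} → Chain K ρ → ∀ pre p post → ρ ≡ pre ++ p ∷ post → ¬ F p → All F post →
              Σ (List C) λ s → Lower s × (ρ ≡ s ⊎ ρ ≡ mate s) × rank s ≡ (height p , length s) ×
                (ρ ≡ s ⊎ Σ (List C) λ r → post ≡ closure p ∷ r × s ≡ pre ++ p ∷ r)
    pair-of c pre p [] refl p∉F post⊆F =
      _ , lower c pre p [] refl p∉F post⊆F tt , inj₁ refl , rank-pivot pre p∉F post⊆F , inj₁ refl
    pair-of c@(_ , ρ⊆K , increasing) pre p (q ∷ r) refl p∉F post⊆F with q ≟ closure p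
    ... | no q≢ =
      _ , lower c pre p (q ∷ r) refl p∉F post⊆F q≢ , inj₁ refl , rank-pivot pre p∉F post⊆F , inj₁ refl
    ... | yes refl = s , ls , inj₂ (sym (mate-lower ls)) , rank-pivot pre p∉F (All.tail post⊆F) ,
                     inj₂ (r , refl , refl)
      where
      s : List C
      s = pre ++ p ∷ r
      s∈K : Chain K s
      s∈K = ++-∷-nonempty pre ,
            All.++⁺ (All.++⁻ˡ pre ρ⊆K)
                    (All.head (All.++⁻ʳ pre ρ⊆K) ∷ All.tail (All.tail (All.++⁻ʳ pre ρ⊆K))) ,
            linked-delete pre increasing
      ls : Lower s
      ls = lower s∈K pre p r refl p∉F (All.tail post⊆F)
                 (linked-not-head (Linked.tail (linked-suffix pre increasing)))

    closure∉lower : ∀ {σ} (l : Lower σ) → closure (p l) ∉ˡ σ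
    closure∉lower l@(lower (_ , _ , increasing) pre p post refl p∉F _ _) c∈σ
      with Membership.∈-++⁻ pre c∈σ
    ... | inj₁ c∈pre = ⊏-irrefl (⊏-trans (linked-before pre increasing c∈pre)
                                         (below-closure (pivot∈K l) p∉F))
    ... | inj₂ (here e) = ⊏-irrefl (subst (p ⊏_) e (below-closure (pivot∈K l) p∉F))
    ... | inj₂ (there c∈post) = ⊏-irrefl (closure-below-post l c∈post)

    same-pivot-longer : ∀ {σ} (lσ : Lower σ) {ρ} → σ SL.⊆ ρ → ρ ≢ σ → ρ ≢ mate σ →
                        ∀ {s} → Lower s → (ρ ≡ s ⊎ ρ ≡ mate s) →
                        ∀ pre' post' → ρ ≡ pre' ++ p lσ ∷ post' →
                        (ρ ≡ s ⊎ Σ (List C) λ r → post' ≡ closure (p lσ) ∷ r × s ≡ pre' ++ p lσ ∷ r) →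
                        length σ < length s
    same-pivot-longer lσ σ⊆ρ ρ≢σ ρ≢τ ls (inj₁ refl) pre' post' _ _ =
      sublist-shorter σ⊆ρ (ρ≢σ ∘ sym)
    same-pivot-longer lσ σ⊆ρ ρ≢σ ρ≢τ ls (inj₂ ρ≡ms) pre' post' _ (inj₁ ρ≡s) =
      ⊥-elim (mate-not-lower ls (subst Lower (trans (sym ρ≡s) ρ≡ms) ls))
    same-pivot-longer {σ} lσ σ⊆ρ ρ≢σ ρ≢τ ls (inj₂ ρ≡ms) pre' .(closure (p lσ) ∷ r) refl
                      (inj₂ (r , refl , refl)) = sublist-shorter σ⊆s σ≢s
      where
      σ⊆s : σ SL.⊆ (pre' ++ p lσ ∷ r)
      σ⊆s = subst (σ SL.⊆_) (List.++-assoc pre' [ p lσ ] r)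
              (sublist-delete (pre' ++ [ p lσ ])
                 (subst (σ SL.⊆_) (sym (List.++-assoc pre' [ p lσ ] (closure (p lσ) ∷ r))) σ⊆ρ)
                 (closure∉lower lσ))
      σ≢s : σ ≢ pre' ++ p lσ ∷ r
      σ≢s e = ρ≢τ (trans ρ≡ms (cong mate (sym e)))

    -- The pivot of σ occurs in ρ ⊇ σ outside F, hence at or before ρ's pivot.
    pivot-⊑ : ∀ {σ ρ} (lσ : Lower σ) → Chain K ρ → σ SL.⊆ ρ →
              ∀ pre' p' post' → ρ ≡ pre' ++ p' ∷ post' → All F post' → p lσ ≡ p' ⊎ p lσ ⊏ p'
    pivot-⊑ lσ@(lower _ pre p post refl p∉F _ _) (_ , _ , increasing) σ⊆ρ pre' p' post' refl post'⊆F
      with Membership.∈-++⁻ pre' (SL.lookup σ⊆ρ (Membership.∈-++⁺ʳ pre (here refl)))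
    ... | inj₁ p∈pre' = inj₂ (linked-before pre' increasing p∈pre')
    ... | inj₂ (here e) = inj₁ e
    ... | inj₂ (there p∈post') = ⊥-elim (p∉F (All.lookup post'⊆F p∈post'))

    -- Acyclicity: a chain above σ other than σ and its mate lies in a pair of
    -- larger rank (larger pivot height, or same pivot and longer).
    acyclic : ∀ {σ ρ} → Lower σ → Chain K ρ → σ SL.⊆ ρ → ρ ≢ σ → ρ ≢ mate σ →
              Σ (List C) λ s → Lower s × (ρ ≡ s ⊎ ρ ≡ mate s) × rank σ ≺ rank s
    acyclic {σ} {ρ} lσ@(lower _ pre p post refl p∉F post⊆F _) ρ∈K σ⊆ρ ρ≢σ ρ≢τ with pivotView ρ
    ... | inside ρ⊆F = ⊥-elim (p∉F (All.lookup ρ⊆F (SL.lookup σ⊆ρ (Membership.∈-++⁺ʳ pre (here refl)))))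
    ... | pivot pre' p' post' eρ p'∉F post'⊆F with pair-of ρ∈K pre' p' post' eρ p'∉F post'⊆F
    ...   | s , ls , ρ∈s , rank-s , shape =
      s , ls , ρ∈s , subst₂ _≺_ (sym (rank-pivot pre p∉F post⊆F)) (sym rank-s)
                            (compare (pivot-⊑ lσ ρ∈K σ⊆ρ pre' p' post' eρ post'⊆F))
      where
      compare : p ≡ p' ⊎ p ⊏ p' → (height p , length σ) ≺ (height p' , length s)
      compare (inj₂ p⊏p') = inj₁ (height-mono (pivot∈K lσ) p'∈K p⊏p')
        where
        p'∈K : K p'
        p'∈K = chain-member ρ∈K (subst (p' ∈ˡ_) (sym eρ) (Membership.∈-++⁺ʳ pre' (here refl)))
      compare (inj₁ refl) = inj₂ (refl , same-pivot-longer lσ σ⊆ρ ρ≢σ ρ≢τ ls ρ∈s pre' post' eρ shape)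

    listsUpTo : ℕ → List (List C)
    listsUpTo zero = [] ∷ []
    listsUpTo (suc n) = [] ∷ concatMap (λ a → map (a ∷_) (listsUpTo n)) cells

    listsUpTo-complete : ∀ n S → All K S → length S ≤ n → S ∈ˡ listsUpTo n
    listsUpTo-complete zero [] _ _ = here refl
    listsUpTo-complete (suc n) [] _ _ = here refl
    listsUpTo-complete (suc n) (a ∷ S) (a∈K ∷ S⊆K) (s≤s |S|≤n) =
      there (Membership.∈-concatMap⁺ (λ b → map (b ∷_) (listsUpTo n))
              (Any.map (λ { refl → Membership.∈-map⁺ (a ∷_) (listsUpTo-complete n S S⊆K |S|≤n) })
                       (cells-complete a∈K)))

    -- Heights strictly increase along a chain, so chains are short.
    chain-length : ∀ h t → Linked _⊏_ (h ∷ t) → All K (h ∷ t) →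
                   length (h ∷ t) + height h ≤ suc maxHeight
    chain-length h [] _ (h∈K ∷ _) = s≤s (height≤max h∈K)
    chain-length h (h' ∷ t) (h⊏h' ∷ l) (h∈K ∷ t⊆K) = begin
      length (h ∷ h' ∷ t) + height h   ≡⟨ sym (ℕ.+-suc (length (h' ∷ t)) (height h)) ⟩
      length (h' ∷ t) + suc (height h) ≤⟨ ℕ.+-monoʳ-≤ (length (h' ∷ t)) (height-mono h∈K (All.head t⊆K) h⊏h') ⟩
      length (h' ∷ t) + height h'      ≤⟨ chain-length h' t l t⊆K ⟩
      suc maxHeight                    ∎
      where open ℕ.≤-Reasoning

    chain-short : ∀ {S} → Chain K S → length S ≤ suc maxHeight
    chain-short {[]} (nonempty , _) = ⊥-elim (nonempty refl)
    chain-short {h ∷ t} (_ , S⊆K , increasing) =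
      ℕ.≤-trans (ℕ.m≤m+n (length (h ∷ t)) (height h)) (chain-length h t increasing S⊆K)

    chain? : ∀ S → Dec (Chain K S)
    chain? [] = no λ c → proj₁ c refl
    chain? (a ∷ S) with All.all? K? (a ∷ S) | Linked.linked? _⊏?_ (a ∷ S)
    ... | yes S⊆K | yes increasing = yes ((λ ()) , S⊆K , increasing)
    ... | no S⊈K | _ = no λ c → S⊈K (proj₁ (proj₂ c))
    ... | _ | no ¬increasing = no λ c → ¬increasing (proj₂ (proj₂ c))

    notHead? : ∀ z post → Dec (NotHead z post)
    notHead? z [] = yes tt
    notHead? z (q ∷ r) with q ≟ z
    ... | yes e = no λ q≢z → q≢z e
    ... | no q≢z = yes q≢z

    lower? : ∀ S → Dec (Lower S)
    lower? S with chain? S | pivotView S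
    ... | no ¬c | _ = no λ l → ¬c (chain l)
    ... | yes c | inside S⊆F =
      no λ { (lower _ pre p _ refl p∉F _ _) → p∉F (All.lookup S⊆F (Membership.∈-++⁺ʳ pre (here refl))) }
    ... | yes c | pivot pre p post e p∉F post⊆F with notHead? (closure p) post
    ...   | yes nh = yes (lower c pre p post e p∉F post⊆F nh)
    ...   | no ¬nh = no λ { (lower _ pre' p' post' e' p'∉F post'⊆F nh') →
              ¬nh (subst (λ { (_ , q , r) → NotHead (closure q) r })
                         (pivot-unique pre' p' post' pre p post (trans (sym e') e)
                                       p'∉F post'⊆F p∉F post⊆F) nh') }

    lowerChains : List (List C)
    lowerChains = filter lower? (listsUpTo (suc maxHeight))

    covering : ∀ S → Chain K S → Inside S ⊎ Σ (List C) λ s → s ∈ˡ lowerChains × (S ≡ s ⊎ S ≡ mate s)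
    covering S c@(nonempty , S⊆K , increasing) with pivotView S
    ... | inside S⊆F = inj₁ (nonempty , All.zip (S⊆K , S⊆F) , increasing)
    ... | pivot pre p post e p∉F post⊆F with pair-of c pre p post e p∉F post⊆F
    ...   | s , ls , S∈s , _ =
      inj₂ (s , Membership.∈-filter⁺ lower? (listsUpTo-complete (suc maxHeight) s
                                               (proj₁ (proj₂ (chain ls))) (chain-short (chain ls))) ls ,
            S∈s)

    closure-collapse : Collapses SL._⊆_ (λ S → length S ∸ 1) (Chain K) Inside
    closure-collapse = MatchingCollapse.matching-collapse (List.≡-dec _≟_) SL._⊆_ (λ S → length S ∸ 1) ℕ²-lex
      record
        { L⊆K = λ (nonempty , S⊆KF , increasing) → nonempty , All.map proj₁ S⊆KF , increasing
        ; Lower = Lower ; mate = mate ; rank = rank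
        ; lower∈K = chain ; lower∉L = lower∉Inside
        ; mate∈K = mate∈K ; mate∉L = mate∉Inside
        ; mate-not-lower = mate-not-lower ; mate-involutive = mate-involutive
        ; lower≼mate = lower⊆mate ; dim-mate = dim-mate ; acyclic = acyclic
        ; lowers = lowerChains ; lowers-lower = All.all-filter lower? (listsUpTo (suc maxHeight))
        ; covering = covering }

module StrictOrder (P : FinPoset) where
  open IsPartialOrder (isPO P) using (antisym) renaming (trans to ≤-trans)

  <-trans : ∀ {a b c} → Lt P a b → Lt P b c → Lt P a c
  <-trans (a≤b , a≢b) (b≤c , _) = ≤-trans a≤b b≤c , λ { refl → a≢b (antisym a≤b b≤c) }

  <-irrefl : ∀ {a} → ¬ Lt P a a
  <-irrefl (_ , a≢a) = a≢a refl

  _<?_ : ∀ a b → Dec (Lt P a b)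
  a <? b = (_≤?_ P a b) ×-dec ¬? (a Fin.≟ b)

-- Proved
-- by well-founded induction, refining a relation b < x through covers.
module Fold (P : FinPoset) (x y : Fin (size P))
            (up : ∀ w → Covers P x w → Covers P y w)
            (down : ∀ w → Covers P w x → Covers P w y) where
  open StrictOrder P

  below-x⇒below-y : ∀ b → Lt P b x → Lt P b y
  below-x⇒below-y b = descend b (po-noetherian (isPO P) b)
    where
    descend : ∀ b → Acc _ b → Lt P b x → Lt P b y
    descend b (acc rs) b<x with Fin.any? (λ c → (b <? c) ×-dec (c <? x))
    ... | yes (c , b<c , c<x) = <-trans b<c (descend c (rs b<c) c<x)
    ... | no no-between = proj₁ (down b (b<x , no-between))

  above-x⇒above-y : ∀ c → Lt P x c → Lt P y c
  above-x⇒above-y c = ascend c (po-wellFounded (isPO P) c)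
    where
    ascend : ∀ c → Acc _ c → Lt P x c → Lt P y c
    ascend c (acc rs) x<c with Fin.any? (λ d → (x <? d) ×-dec (d <? c))
    ... | yes (d , x<d , d<c) = <-trans (ascend d (rs d<c) x<d) d<c
    ... | no no-between = proj₁ (up c (x<c , no-between))

true≢false : true ≢ false
true≢false ()

nothing≢just : ∀ {A : Set} {a : A} → nothing ≢ just a
nothing≢just ()

∈⇒true : ∀ {n} {u : Fin n} {s : Subset n} → u ∈ s → lookup s u ≡ true
∈⇒true = Vec.[]=⇒lookup

true⇒∈ : ∀ {n} {u : Fin n} {s : Subset n} → lookup s u ≡ true → u ∈ s
true⇒∈ {u = u} {s} = Vec.lookup⇒[]= u s

subset-≟ : ∀ {n} → DecidableEquality (Subset n)
subset-≟ = Vec.≡-dec Data.Bool._≟_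

⊆-≢⇒∣∣< : ∀ {n} {s t : Subset n} → s ⊆ t → s ≢ t → ∣ s ∣ < ∣ t ∣
⊆-≢⇒∣∣< {s = []} {[]} _ s≢t = ⊥-elim (s≢t refl)
⊆-≢⇒∣∣< {s = outside ∷ s} {outside ∷ t} s⊆t s≢t =
  ⊆-≢⇒∣∣< (Subset.drop-∷-⊆ s⊆t) (s≢t ∘ cong (outside ∷_))
⊆-≢⇒∣∣< {s = outside ∷ s} {inside ∷ t} s⊆t _ = s≤s (Subset.p⊆q⇒∣p∣≤∣q∣ (Subset.drop-∷-⊆ s⊆t))
⊆-≢⇒∣∣< {s = inside ∷ s} {outside ∷ t} s⊆t _ with s⊆t Data.Vec.here
... | ()
⊆-≢⇒∣∣< {s = inside ∷ s} {inside ∷ t} s⊆t s≢t =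
  s≤s (⊆-≢⇒∣∣< (Subset.drop-∷-⊆ s⊆t) (s≢t ∘ cong (inside ∷_)))

∣insert∣ : ∀ {k} (s : Subset k) i → lookup s i ≡ false → ∣ s [ i ]≔ true ∣ ≡ suc ∣ s ∣
∣insert∣ (false ∷ s) zero _ = refl
∣insert∣ (true ∷ s) zero ()
∣insert∣ (true ∷ s) (suc i) e = cong suc (∣insert∣ s i e)
∣insert∣ (false ∷ s) (suc i) e = ∣insert∣ s i e

nonempty⇒∣∣>0 : ∀ {n} {s : Subset n} → Nonempty s → 0 < ∣ s ∣
nonempty⇒∣∣>0 {s = s} (u , u∈s) =
  subst (_≤ ∣ s ∣) (Subset.∣⁅x⁆∣≡1 u)
        (Subset.p⊆q⇒∣p∣≤∣q∣ λ v∈⁅u⁆ → subst (_∈ s) (sym (Subset.x∈⁅y⁆⇒x≡y u v∈⁅u⁆)) u∈s)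

cell-ext : ∀ {n m} {X Y : Vec (Subset n) m} → (∀ a → lookup X a ≡ lookup Y a) → X ≡ Y
cell-ext {X = X} {Y} X≗Y =
  trans (sym (Vec.tabulate∘lookup X)) (trans (Vec.tabulate-cong X≗Y) (Vec.tabulate∘lookup Y))

⊑-antisym : ∀ {A B} {X Y : Cell A B} → _⊑_ {A} {B} X Y → _⊑_ {A} {B} Y X → X ≡ Y
⊑-antisym X⊑Y Y⊑X = cell-ext λ a → Subset.⊆-antisym (X⊑Y a) (Y⊑X a)

module Dimension {n : ℕ} where

  dimSum : ∀ {m} → Vec (Subset n) m → ℕ
  dimSum X = Data.Vec.sum (Data.Vec.map (λ (s : Subset n) → ∣ s ∣ ∸ 1) X)

  dimSum-mono : ∀ {m} {X Y : Vec (Subset n) m} → (∀ a → lookup X a ⊆ lookup Y a) →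
                dimSum X ≤ dimSum Y
  dimSum-mono {X = []} {[]} _ = z≤n
  dimSum-mono {X = x ∷ X} {y ∷ Y} X⊑Y =
    ℕ.+-mono-≤ (ℕ.∸-monoˡ-≤ 1 (Subset.p⊆q⇒∣p∣≤∣q∣ (X⊑Y zero))) (dimSum-mono {X = X} {Y} (X⊑Y ∘ suc))

  dimSum-strict : ∀ {m} {X Y : Vec (Subset n) m} → (∀ a → Nonempty (lookup X a)) →
                  (∀ a → lookup X a ⊆ lookup Y a) → X ≢ Y → dimSum X < dimSum Y
  dimSum-strict {X = []} {[]} _ _ X≢Y = ⊥-elim (X≢Y refl)
  dimSum-strict {X = x ∷ X} {y ∷ Y} nonempty X⊑Y X≢Y with subset-≟ x y
  ... | yes refl = ℕ.+-monoʳ-< (∣ x ∣ ∸ 1)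
                     (dimSum-strict {X = X} {Y} (nonempty ∘ suc) (X⊑Y ∘ suc) (X≢Y ∘ cong (x ∷_)))
  ... | no x≢y = ℕ.+-mono-<-≤ (ℕ.∸-monoˡ-< (⊆-≢⇒∣∣< (X⊑Y zero) x≢y) (nonempty⇒∣∣>0 (nonempty zero)))
                              (dimSum-mono {X = X} {Y} (X⊑Y ∘ suc))

  dimSum-update : ∀ {m} (X : Vec (Subset n) m) a t → ∣ t ∣ ∸ 1 ≡ suc (∣ lookup X a ∣ ∸ 1) →
                  dimSum (X [ a ]≔ t) ≡ suc (dimSum X)
  dimSum-update (x ∷ X) zero t e = cong (_+ dimSum X) e
  dimSum-update (x ∷ X) (suc a) t e =
    trans (cong (∣ x ∣ ∸ 1 +_) (dimSum-update X a t e)) (ℕ.+-suc (∣ x ∣ ∸ 1) (dimSum X))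

  dimSum-bound : ∀ {m} (X : Vec (Subset n) m) → dimSum X ≤ m * n
  dimSum-bound [] = z≤n
  dimSum-bound (x ∷ X) = ℕ.+-mono-≤ (ℕ.≤-trans (ℕ.m∸n≤m ∣ x ∣ 1) (Subset.∣p∣≤n x)) (dimSum-bound X)

allVecs : ∀ {A : Set} → List A → (m : ℕ) → List (Vec A m)
allVecs l zero = [] ∷ []
allVecs l (suc m) = concatMap (λ a → map (a ∷_) (allVecs l m)) l

allVecs-complete : ∀ {A : Set} (l : List A) → (∀ a → a ∈ˡ l) →
                   ∀ {m} (v : Vec A m) → v ∈ˡ allVecs l m
allVecs-complete l l-complete [] = here refl
allVecs-complete l l-complete (a ∷ v) =
  Membership.∈-concatMap⁺ (λ b → map (b ∷_) (allVecs l _))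
    (Any.map (λ { refl → Membership.∈-map⁺ (a ∷_) (allVecs-complete l l-complete v) }) (l-complete a))

allCells : (A B : FinPoset) → List (Cell A B)
allCells A B = allVecs (allVecs (true ∷ false ∷ []) (size B)) (size A)

allCells-complete : ∀ {A B} (X : Cell A B) → X ∈ˡ allCells A B
allCells-complete = allVecs-complete _ (allVecs-complete _ λ { true → here refl ; false → there (here refl) })

module HomCells (A B : FinPoset) where

  NonemptyEntries : Cell A B → Set
  NonemptyEntries X = ∀ a → Nonempty (lookup X a)

  Separated : Cell A B → Set
  Separated X = ∀ a a' u v → Lt A a a' → u ∈ lookup X a → v ∈ lookup X a' → Lt B u v

  -- Separation is equivalent to the defining condition "every selection is
  -- strictly order preserving": extend u and v to a selection.
  hom⇒separated : ∀ X → HomCell A B X → Separated X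
  hom⇒separated X (nonempty , strict) a a' u v a<a' u∈ v∈ =
    subst₂ (Lt B) pick-a pick-a' (strict pick pick∈ a a' a<a')
    where
    pick : Fin (size A) → Fin (size B)
    pick b with b Fin.≟ a | b Fin.≟ a'
    ... | yes _ | _ = u
    ... | no _ | yes _ = v
    ... | no _ | no _ = proj₁ (nonempty b)
    pick∈ : ∀ b → pick b ∈ lookup X b
    pick∈ b with b Fin.≟ a | b Fin.≟ a'
    ... | yes refl | _ = u∈
    ... | no _ | yes refl = v∈
    ... | no _ | no _ = proj₂ (nonempty b)
    pick-a : pick a ≡ u
    pick-a with a Fin.≟ a
    ... | yes _ = refl
    ... | no a≢a = ⊥-elim (a≢a refl)
    pick-a' : pick a' ≡ v
    pick-a' with a' Fin.≟ a | a' Fin.≟ a'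
    ... | yes a'≡a | _ = ⊥-elim (proj₂ a<a' (sym a'≡a))
    ... | no _ | yes _ = refl
    ... | no _ | no a'≢a' = ⊥-elim (a'≢a' refl)

  separated⇒hom : ∀ X → NonemptyEntries X → Separated X → HomCell A B X
  separated⇒hom X nonempty sep = nonempty , λ η η∈ a a' a<a' → sep a a' (η a) (η a') a<a' (η∈ a) (η∈ a')

  homCell? : ∀ X → Dec (HomCell A B X)
  homCell? X with Fin.all? (λ a → Subset.nonempty? (lookup X a)) | separated? X
    where
    open StrictOrder
    separated? : ∀ X → Dec (Separated X)
    separated? X = Fin.all? λ a → Fin.all? λ a' → Fin.all? λ u → Fin.all? λ v →
      _<?_ A a a' →-dec ((u Subset.∈? lookup X a) →-dec ((v Subset.∈? lookup X a') →-dec _<?_ B u v))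
  ... | yes nonempty | yes sep = yes (separated⇒hom X nonempty sep)
  ... | no ¬nonempty | _ = no λ h → ¬nonempty (proj₁ h)
  ... | yes _ | no ¬sep = no λ h → ¬sep (hom⇒separated X h)

  hom-face : ∀ X Y → NonemptyEntries X → _⊑_ {A} {B} X Y → HomCell A B Y → HomCell A B X
  hom-face X Y nonempty X⊑Y (_ , strict) = nonempty , λ η η∈ → strict η (λ a → X⊑Y a (η∈ a))

module CellOrder (A B : FinPoset) where

  cell-≟ : DecidableEquality (Cell A B)
  cell-≟ = Vec.≡-dec subset-≟

  ⊏-trans : ∀ {X Y Z} → _⊏_ {A} {B} X Y → _⊏_ {A} {B} Y Z → _⊏_ {A} {B} X Z
  ⊏-trans {X} {Y} (X⊑Y , X≢Y) (Y⊑Z , _) =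
    (λ a → Y⊑Z a ∘ X⊑Y a) ,
    λ { refl → X≢Y (⊑-antisym {A} {B} {X} {Y} X⊑Y Y⊑Z) }

  ⊏-irrefl : ∀ {X} → ¬ _⊏_ {A} {B} X X
  ⊏-irrefl (_ , X≢X) = X≢X refl

  _⊏?_ : ∀ X Y → Dec (_⊏_ {A} {B} X Y)
  X ⊏? Y = Fin.all? (λ a → lookup X a Subset.⊆? lookup Y a) ×-dec ¬? (cell-≟ X Y)

  ⊑⇒≡⊎⊏ : ∀ {X Z} → _⊑_ {A} {B} X Z → X ≡ Z ⊎ _⊏_ {A} {B} X Z
  ⊑⇒≡⊎⊏ {X} {Z} X⊑Z with cell-≟ X Z
  ... | yes X≡Z = inj₁ X≡Z
  ... | no X≢Z = inj₂ (X⊑Z , X≢Z)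

  dim-strict : ∀ {X Y} → HomCell A B X → _⊏_ {A} {B} X Y → cellDim {A} {B} X < cellDim {A} {B} Y
  dim-strict {X} {Y} (nonempty , _) (X⊑Y , X≢Y) = Dimension.dimSum-strict {X = X} {Y} nonempty X⊑Y X≢Y

-- A cell X using x is matched by
-- toggling y in the entry X_a at the first index a with x ∈ X_a; since y has
-- the comparabilities of x, adding y keeps X a cell of Hom(Q,P).
module HomFold (P Q : FinPoset) (x y : Fin (size P)) (y≢x : y ≢ x)
               (up : ∀ w → Covers P x w → Covers P y w)
               (down : ∀ w → Covers P w x → Covers P w y) where

  open Fold P x y up down
  open HomCells Q P
  open Dimension

  n : ℕ
  n = size P

  m : ℕ
  m = size Q

  C : Set
  C = Cell Q P

  x≢y : x ≢ y
  x≢y = y≢x ∘ sym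

  toggle : Subset n → Subset n
  toggle s = s [ y ]≔ not (lookup s y)

  toggle-other : ∀ {u} (s : Subset n) → u ≢ y → lookup (toggle s) u ≡ lookup s u
  toggle-other s u≢y = Vec.lookup∘update′ u≢y s _

  toggle-y : ∀ (s : Subset n) → lookup (toggle s) y ≡ not (lookup s y)
  toggle-y s = Vec.lookup∘update y s _

  toggle-involutive : ∀ (s : Subset n) → toggle (toggle s) ≡ s
  toggle-involutive s = begin
    toggle s [ y ]≔ not (lookup (toggle s) y)  ≡⟨ cong (λ b → toggle s [ y ]≔ not b) (toggle-y s) ⟩
    toggle s [ y ]≔ not (not (lookup s y))     ≡⟨ Vec.[]≔-idempotent s y ⟩
    s [ y ]≔ not (not (lookup s y))            ≡⟨ cong (s [ y ]≔_) (Bool.not-involutive (lookup s y)) ⟩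
    s [ y ]≔ lookup s y                        ≡⟨ Vec.[]≔-lookup s y ⟩
    s                                          ∎
    where open ≡-Reasoning

  ∣toggle∣ : ∀ (s : Subset n) → lookup s y ≡ false → ∣ toggle s ∣ ≡ suc ∣ s ∣
  ∣toggle∣ s y∉s rewrite y∉s = ∣insert∣ s y y∉s

  firstX : ∀ {k} → Vec (Subset n) k → Maybe (Fin k)
  firstX [] = nothing
  firstX (s ∷ X) with lookup s x
  ... | true = just zero
  ... | false = Maybe.map suc (firstX X)

  firstX-contains : ∀ {k} (X : Vec (Subset n) k) {a} → firstX X ≡ just a → lookup (lookup X a) x ≡ true
  firstX-contains (s ∷ X) {a} e with lookup s x in x∈s
  firstX-contains (s ∷ X) {zero} refl | true = x∈s
  firstX-contains (s ∷ X) {a} e | false with firstX X in first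
  firstX-contains (s ∷ X) {suc a} refl | false | just .a = firstX-contains X first

  firstX-least : ∀ {k} (X : Vec (Subset n) k) {a} b → firstX X ≡ just a →
                 lookup (lookup X b) x ≡ true → toℕ a ≤ toℕ b
  firstX-least (s ∷ X) {a} b e x∈ with lookup s x in x∈s
  firstX-least (s ∷ X) {zero} b refl x∈ | true = z≤n
  firstX-least (s ∷ X) {a} b e x∈ | false with firstX X in first
  firstX-least (s ∷ X) {suc a} zero refl x∈ | false | just .a = ⊥-elim (true≢false (trans (sym x∈) x∈s))
  firstX-least (s ∷ X) {suc a} (suc b) refl x∈ | false | just .a = s≤s (firstX-least X b first x∈)

  firstX-none : ∀ {k} (X : Vec (Subset n) k) → firstX X ≡ nothing → ∀ b → lookup (lookup X b) x ≡ false
  firstX-none (s ∷ X) e b with lookup s x in x∈s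
  firstX-none (s ∷ X) () b | true
  firstX-none (s ∷ X) e b | false with firstX X in first
  firstX-none (s ∷ X) e zero | false | nothing = x∈s
  firstX-none (s ∷ X) e (suc b) | false | nothing = firstX-none X first b
  firstX-none (s ∷ X) () b | false | just _

  firstX-update : ∀ {k} (X : Vec (Subset n) k) a t → lookup t x ≡ lookup (lookup X a) x →
                  firstX (X [ a ]≔ t) ≡ firstX X
  firstX-update (s ∷ X) zero t e rewrite e = refl
  firstX-update (s ∷ X) (suc a) t e with lookup s x
  ... | true = refl
  ... | false = cong (Maybe.map suc) (firstX-update X a t e)

  mateAt : Maybe (Fin m) → C → C
  mateAt (just a) X = X [ a ]≔ toggle (lookup X a)
  mateAt nothing X = X

  mate : C → C
  mate X = mateAt (firstX X) X

  mate-at : ∀ X {a} → firstX X ≡ just a → mate X ≡ X [ a ]≔ toggle (lookup X a)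
  mate-at X e rewrite e = refl

  firstX-mate : ∀ X {a} → firstX X ≡ just a → firstX (mate X) ≡ just a
  firstX-mate X {a} e =
    trans (cong firstX (mate-at X e)) (trans (firstX-update X a _ (toggle-other (lookup X a) x≢y)) e)

  lookup-mate : ∀ X {a} → firstX X ≡ just a → lookup (mate X) a ≡ toggle (lookup X a)
  lookup-mate X {a} e = trans (cong (λ Z → lookup Z a) (mate-at X e)) (Vec.lookup∘update a X _)

  lookup-mate′ : ∀ X {a} b → firstX X ≡ just a → b ≢ a → lookup (mate X) b ≡ lookup X b
  lookup-mate′ X {a} b e b≢a = trans (cong (λ Z → lookup Z b) (mate-at X e)) (Vec.lookup∘update′ b≢a X _)

  mate-involutive : ∀ X {a} → firstX X ≡ just a → mate (mate X) ≡ X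
  mate-involutive X {a} e = begin
    mate (mate X)                                         ≡⟨ mate-at (mate X) (firstX-mate X e) ⟩
    mate X [ a ]≔ toggle (lookup (mate X) a)              ≡⟨ cong₂ (λ Z t → Z [ a ]≔ toggle t) (mate-at X e) (lookup-mate X e) ⟩
    (X [ a ]≔ toggle (lookup X a)) [ a ]≔ toggle (toggle (lookup X a)) ≡⟨ Vec.[]≔-idempotent X a ⟩
    X [ a ]≔ toggle (toggle (lookup X a))                 ≡⟨ cong (X [ a ]≔_) (toggle-involutive (lookup X a)) ⟩
    X [ a ]≔ lookup X a                                   ≡⟨ Vec.[]≔-lookup X a ⟩
    X                                                     ∎
    where open ≡-Reasoning

  mate-members : ∀ X {a} → firstX X ≡ just a → ∀ b u → u ∈ lookup (mate X) b →
                 u ∈ lookup X b ⊎ (b ≡ a × u ≡ y)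
  mate-members X {a} e b u u∈ with b Fin.≟ a | u Fin.≟ y
  ... | yes refl | yes refl = inj₂ (refl , refl)
  ... | no b≢a | _ = inj₁ (subst (u ∈_) (lookup-mate′ X b e b≢a) u∈)
  ... | yes refl | no u≢y =
    inj₁ (true⇒∈ (trans (sym (toggle-other (lookup X b) u≢y))
                        (trans (cong (λ t → lookup t u) (sym (lookup-mate X e))) (∈⇒true u∈))))

  mate-keeps : ∀ X {a} → firstX X ≡ just a → ∀ b u → u ∈ lookup X b → u ≢ y → u ∈ lookup (mate X) b
  mate-keeps X {a} e b u u∈ u≢y with b Fin.≟ a
  ... | yes refl = true⇒∈ (trans (cong (λ t → lookup t u) (lookup-mate X e))
                                 (trans (toggle-other (lookup X b) u≢y) (∈⇒true u∈)))
  ... | no b≢a = subst (u ∈_) (sym (lookup-mate′ X b e b≢a)) u∈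

  x∈first : ∀ (X : C) {a} → firstX X ≡ just a → x ∈ lookup X a
  x∈first X e = true⇒∈ (firstX-contains X e)

  mate-nonempty : ∀ X {a} → firstX X ≡ just a → NonemptyEntries X → NonemptyEntries (mate X)
  mate-nonempty X {a} e nonempty b with b Fin.≟ a
  ... | yes refl = x , mate-keeps X e b x (x∈first X e) x≢y
  ... | no b≢a = subst Nonempty (sym (lookup-mate′ X b e b≢a)) (nonempty b)

  -- Adding y next to x keeps a cell separated, since y is comparable to
  -- exactly what x is comparable to.
  mate∈Hom : ∀ X {a} → firstX X ≡ just a → HomCell Q P X → HomCell Q P (mate X)
  mate∈Hom X {a} e h = separated⇒hom (mate X) (mate-nonempty X e (proj₁ h)) separated
    where
    sepX : Separated X
    sepX = hom⇒separated X h
    separated : Separated (mate X)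
    separated a₁ a₂ u v a₁<a₂ u∈ v∈ with mate-members X e a₁ u u∈ | mate-members X e a₂ v v∈
    ... | inj₁ u∈X | inj₁ v∈X = sepX a₁ a₂ u v a₁<a₂ u∈X v∈X
    ... | inj₁ u∈X | inj₂ (refl , refl) = below-x⇒below-y u (sepX a₁ a u x a₁<a₂ u∈X (x∈first X e))
    ... | inj₂ (refl , refl) | inj₁ v∈X = above-x⇒above-y v (sepX a a₂ x v a₁<a₂ (x∈first X e) v∈X)
    ... | inj₂ (refl , refl) | inj₂ (refl , _) = ⊥-elim (StrictOrder.<-irrefl Q a₁<a₂)

  record Lower (X : C) : Set where
    constructor lower
    field
      cell      : HomCell Q P X
      index     : Fin m
      first     : firstX X ≡ just index
      y∉        : lookup (lookup X index) y ≡ false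
  open Lower

  lower⊑mate : ∀ X {a} → firstX X ≡ just a → lookup (lookup X a) y ≡ false → _⊑_ {Q} {P} X (mate X)
  lower⊑mate X {a} e y∉ b {u} u∈ with u Fin.≟ y
  ... | no u≢y = mate-keeps X e b u u∈ u≢y
  ... | yes refl with b Fin.≟ a
  ...   | yes refl = ⊥-elim (true≢false (trans (sym (∈⇒true u∈)) y∉))
  ...   | no b≢a = subst (u ∈_) (sym (lookup-mate′ X b e b≢a)) u∈

  dim-mate : ∀ X {a} → firstX X ≡ just a → Nonempty (lookup X a) → lookup (lookup X a) y ≡ false →
             cellDim {Q} {P} (mate X) ≡ suc (cellDim {Q} {P} X)
  dim-mate X {a} e nonempty y∉ = trans (cong dimSum (mate-at X e)) (dimSum-update X a _ one-more)
    where
    s = lookup X a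
    one-more : ∣ toggle s ∣ ∸ 1 ≡ suc (∣ s ∣ ∸ 1)
    one-more = trans (cong (_∸ 1) (∣toggle∣ s y∉))
                     (sym (ℕ.suc-pred ∣ s ∣ {{Data.Nat.>-nonZero (nonempty⇒∣∣>0 nonempty)}}))

  mate-lower : ∀ ρ {a} → HomCell Q P ρ → firstX ρ ≡ just a → lookup (lookup ρ a) y ≡ true → Lower (mate ρ)
  mate-lower ρ {a} h e y∈ =
    lower (hom-face (mate ρ) ρ (mate-nonempty ρ e (proj₁ h)) mate⊑ρ h) a (firstX-mate ρ e) y∉mate
    where
    mate⊑ρ : _⊑_ {Q} {P} (mate ρ) ρ
    mate⊑ρ b {u} u∈ with mate-members ρ e b u u∈
    ... | inj₁ u∈ρ = u∈ρ
    ... | inj₂ (refl , refl) = true⇒∈ y∈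
    y∉mate : lookup (lookup (mate ρ) a) y ≡ false
    y∉mate = trans (cong (λ t → lookup t y) (lookup-mate ρ e)) (trans (toggle-y (lookup ρ a)) (cong not y∈))

  mate-not-lower : ∀ {X} → Lower X → ¬ Lower (mate X)
  mate-not-lower {X} (lower _ a e y∉) (lower _ a' e' y∉')
    with Maybe.just-injective (trans (sym (firstX-mate X e)) e')
  ... | refl = true≢false (begin
    true                              ≡⟨ cong not (sym y∉) ⟩
    not (lookup (lookup X a) y)       ≡⟨ sym (toggle-y (lookup X a)) ⟩
    lookup (toggle (lookup X a)) y    ≡⟨ cong (λ t → lookup t y) (sym (lookup-mate X e)) ⟩
    lookup (lookup (mate X) a) y      ≡⟨ y∉' ⟩
    false                             ∎)
    where open ≡-Reasoning

  score : Maybe (Fin m) → ℕ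
  score (just a) = m ∸ toℕ a
  score nothing = 0

  rank : C → ℕ × ℕ
  rank X = cellDim {Q} {P} X , score (firstX X)

  rank-at : ∀ X {a} → firstX X ≡ just a → rank X ≡ (cellDim {Q} {P} X , m ∸ toℕ a)
  rank-at X e rewrite e = refl

  -- If ρ ⊋ σ (σ lower) has its first x-entry at a' containing y, then the
  -- lower mate s of ρ has larger rank than σ: s has at least the dimension
  -- of σ and its x-entry is not later; if it is at the same place, s even
  -- contains σ properly.
  rank-below-upper : ∀ {σ ρ a'} (lσ : Lower σ) → HomCell Q P ρ → _⊑_ {Q} {P} σ ρ →
                     ρ ≢ σ → ρ ≢ mate σ → firstX ρ ≡ just a' → lookup (lookup ρ a') y ≡ true →
                     (cellDim {Q} {P} σ , m ∸ toℕ (index lσ)) ≺ (cellDim {Q} {P} (mate ρ) , m ∸ toℕ a')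
  rank-below-upper {σ} {ρ} {a'} (lower hσ a eσ y∉σ) hρ σ⊑ρ ρ≢σ ρ≢τ eρ y∈ρ =
    compare (ℕ.m≤n⇒m<n∨m≡n a'≤a)
    where
    s : C
    s = mate ρ
    σ<ρ : cellDim {Q} {P} σ < cellDim {Q} {P} ρ
    σ<ρ = dimSum-strict {X = σ} {ρ} (proj₁ hσ) σ⊑ρ (ρ≢σ ∘ sym)
    ρ≡1+s : cellDim {Q} {P} ρ ≡ suc (cellDim {Q} {P} s)
    ρ≡1+s = trans (cong (cellDim {Q} {P}) (sym (mate-involutive ρ eρ)))
                  (dim-mate s (firstX-mate ρ eρ) (proj₁ (cell ls) a') (y∉ ls))
      where
      ls : Lower s
      ls = mate-lower ρ hρ eρ y∈ρ
    a'≤a : toℕ a' ≤ toℕ a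
    a'≤a = firstX-least ρ a eρ (∈⇒true (σ⊑ρ a (x∈first σ eσ)))
    compare : toℕ a' < toℕ a ⊎ toℕ a' ≡ toℕ a →
              (cellDim {Q} {P} σ , m ∸ toℕ a) ≺ (cellDim {Q} {P} s , m ∸ toℕ a')
    compare (inj₁ a'<a) = ≺-from-≤-< (ℕ.≤-pred (subst (cellDim {Q} {P} σ <_) ρ≡1+s σ<ρ))
                                     (ℕ.∸-monoʳ-< a'<a (ℕ.<⇒≤ (Fin.toℕ<n a)))
    compare (inj₂ a'≡a) with Fin.toℕ-injective a'≡a
    ... | refl = inj₁ (dimSum-strict {X = σ} {s} (proj₁ hσ) σ⊑s σ≢s)
      where
      σ⊑s : _⊑_ {Q} {P} σ s
      σ⊑s b {u} u∈ with b Fin.≟ a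
      ... | no b≢a = subst (u ∈_) (sym (lookup-mate′ ρ b eρ b≢a)) (σ⊑ρ b u∈)
      ... | yes refl = mate-keeps ρ eρ b u (σ⊑ρ b u∈)
                         λ { refl → true≢false (trans (sym (∈⇒true u∈)) y∉σ) }
      σ≢s : σ ≢ s
      σ≢s σ≡s = ρ≢τ (trans (sym (mate-involutive ρ eρ)) (cong mate (sym σ≡s)))

  acyclic : ∀ {σ ρ} → Lower σ → HomCell Q P ρ → _⊑_ {Q} {P} σ ρ → ρ ≢ σ → ρ ≢ mate σ →
            Σ C λ s → Lower s × (ρ ≡ s ⊎ ρ ≡ mate s) × rank σ ≺ rank s
  acyclic {σ} {ρ} lσ@(lower hσ a eσ _) hρ σ⊑ρ ρ≢σ ρ≢τ with firstX ρ in eρ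
  ... | nothing = ⊥-elim (true≢false (trans (sym (∈⇒true (σ⊑ρ a (x∈first σ eσ)))) (firstX-none ρ eρ a)))
  ... | just a' with lookup (lookup ρ a') y in y∈?
  ...   | false = ρ , lower hρ a' eρ y∈? , inj₁ refl ,
      subst₂ _≺_ (sym (rank-at σ eσ)) (sym (rank-at ρ eρ))
             (inj₁ (dimSum-strict {X = σ} {ρ} (proj₁ hσ) σ⊑ρ (ρ≢σ ∘ sym)))
  ...   | true = mate ρ , ls , inj₂ (sym (mate-involutive ρ eρ)) ,
      subst₂ _≺_ (sym (rank-at σ eσ)) (sym (rank-at (mate ρ) (first ls)))
             (rank-below-upper lσ hρ σ⊑ρ ρ≢σ ρ≢τ eρ y∈?)
    where
    ls : Lower (mate ρ)
    ls = mate-lower ρ hρ eρ y∈?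

  lower? : ∀ X → Dec (Lower X)
  lower? X with homCell? X | firstX X in e
  ... | no ¬h | _ = no (¬h ∘ cell)
  ... | yes h | nothing = no λ l → nothing≢just (trans (sym e) (first l))
  ... | yes h | just a with lookup (lookup X a) y in y∈?
  ...   | false = yes (lower h a e y∈?)
  ...   | true = no λ l → true≢false (trans (sym y∈?)
            (subst (λ b → lookup (lookup X b) y ≡ false) (Maybe.just-injective (trans (sym (first l)) e)) (y∉ l)))

  lowerCells : List C
  lowerCells = filter lower? (allCells Q P)

  covering : ∀ X → HomCell Q P X →
             HomAvoid Q P x X ⊎ Σ C λ s → s ∈ˡ lowerCells × (X ≡ s ⊎ X ≡ mate s)
  covering X h with firstX X in e
  ... | nothing = inj₁ (h , λ b x∈ → true≢false (trans (sym (∈⇒true x∈)) (firstX-none X e b)))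
  ... | just a with lookup (lookup X a) y in y∈?
  ...   | false = inj₂ (X , Membership.∈-filter⁺ lower? (allCells-complete {Q} {P} X) (lower h a e y∈?) , inj₁ refl)
  ...   | true = inj₂ (mate X , Membership.∈-filter⁺ lower? (allCells-complete {Q} {P} (mate X)) (mate-lower X h e y∈?) ,
                       inj₂ (sym (mate-involutive X e)))

  hom-collapse : Collapses (_⊑_ {Q} {P}) (cellDim {Q} {P}) (HomCx Q P) (HomAvoid Q P x)
  hom-collapse = MatchingCollapse.matching-collapse (Vec.≡-dec subset-≟) (_⊑_ {Q} {P}) (cellDim {Q} {P}) ℕ²-lex
    record
      { L⊆K = proj₁
      ; Lower = Lower ; mate = mate ; rank = rank
      ; lower∈K = cell
      ; lower∉L = λ { {X} (lower _ a e _) (_ , avoids) → avoids a (x∈first X e) }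
      ; mate∈K = λ { {X} (lower h a e _) → mate∈Hom X e h }
      ; mate∉L = λ { {X} (lower _ a e _) (_ , avoids) → avoids a (mate-keeps X e a x (x∈first X e) x≢y) }
      ; mate-not-lower = mate-not-lower
      ; mate-involutive = λ { {X} (lower _ _ e _) → mate-involutive X e }
      ; lower≼mate = λ { {X} (lower _ _ e y∉) → lower⊑mate X e y∉ }
      ; dim-mate = λ { {X} (lower h a e y∉) → dim-mate X e (proj₁ h a) y∉ }
      ; acyclic = acyclic
      ; lowers = lowerCells
      ; lowers-lower = All.all-filter lower? (allCells Q P)
      ; covering = covering }

module Replace (A B : FinPoset) (x : Fin (size A)) where

  _⊑ᶜ_ : Cell A B → Cell A B → Set
  _⊑ᶜ_ = _⊑_ {A} {B}

  lookup-x : ∀ (X : Cell A B) t → lookup (X [ x ]≔ t) x ≡ t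
  lookup-x X t = Vec.lookup∘update x X t

  lookup-other : ∀ (X : Cell A B) t b → b ≢ x → lookup (X [ x ]≔ t) b ≡ lookup X b
  lookup-other X t b b≢x = Vec.lookup∘update′ b≢x X t

  replaced-⊑ : ∀ {X Z : Cell A B} {t} → t ⊆ lookup Z x →
               (∀ b → b ≢ x → lookup X b ⊆ lookup Z b) → (X [ x ]≔ t) ⊑ᶜ Z
  replaced-⊑ {X} {Z} {t} t⊆ rest b {u} u∈ with b Fin.≟ x
  ... | yes refl = t⊆ (subst (u ∈_) (lookup-x X t) u∈)
  ... | no b≢x = rest b b≢x (subst (u ∈_) (lookup-other X t b b≢x) u∈)

  ⊑-replaced : ∀ {X Z : Cell A B} {t} → lookup Z x ⊆ t →
               (∀ b → b ≢ x → lookup Z b ⊆ lookup X b) → Z ⊑ᶜ (X [ x ]≔ t)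
  ⊑-replaced {X} {Z} {t} ⊆t rest b {u} u∈ with b Fin.≟ x
  ... | yes refl = subst (u ∈_) (sym (lookup-x X t)) (⊆t u∈)
  ... | no b≢x = subst (u ∈_) (sym (lookup-other X t b b≢x)) (rest b b≢x u∈)

  replaced-members : ∀ (X : Cell A B) t b u → u ∈ lookup (X [ x ]≔ t) b →
                     (b ≡ x × u ∈ t) ⊎ (b ≢ x × u ∈ lookup X b)
  replaced-members X t b u u∈ with b Fin.≟ x
  ... | yes refl = inj₁ (refl , subst (u ∈_) (lookup-x X t) u∈)
  ... | no b≢x = inj₂ (b≢x , subst (u ∈_) (lookup-other X t b b≢x) u∈)

module BdFold (P Q : FinPoset) (x y : Fin (size P)) (y≢x : y ≢ x)
              (up : ∀ w → Covers P x w → Covers P y w)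
              (down : ∀ w → Covers P w x → Covers P w y) where

  open Fold P x y up down
  open HomCells P Q
  open CellOrder P Q
  open Replace P Q x

  C : Set
  C = Cell P Q

  _⊏ᶜ_ : C → C → Set
  _⊏ᶜ_ = _⊏_ {P} {Q}

  -- Replacing X_x by a nonempty subset of X_x ∪ X_y keeps a Hom cell, since
  -- y is comparable to exactly what x is comparable to.
  replace-x∈Hom : ∀ (X : C) t → HomCell P Q X → (∀ {u} → u ∈ t → u ∈ lookup X x ⊎ u ∈ lookup X y) →
                  Nonempty t → HomCell P Q (X [ x ]≔ t)
  replace-x∈Hom X t h t⊆ t-nonempty = separated⇒hom (X [ x ]≔ t) nonempty separated
    where
    sepX : Separated X
    sepX = hom⇒separated X h
    nonempty : NonemptyEntries (X [ x ]≔ t)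
    nonempty b with b Fin.≟ x
    ... | yes refl = subst Nonempty (sym (lookup-x X t)) t-nonempty
    ... | no b≢x = subst Nonempty (sym (lookup-other X t b b≢x)) (proj₁ h b)
    separated : Separated (X [ x ]≔ t)
    separated a₁ a₂ u v a₁<a₂ u∈ v∈ with replaced-members X t a₁ u u∈ | replaced-members X t a₂ v v∈
    ... | inj₁ (refl , _) | inj₁ (refl , _) = ⊥-elim (StrictOrder.<-irrefl P a₁<a₂)
    ... | inj₁ (refl , u∈t) | inj₂ (_ , v∈X) with t⊆ u∈t
    ...   | inj₁ u∈Xx = sepX x a₂ u v a₁<a₂ u∈Xx v∈X
    ...   | inj₂ u∈Xy = sepX y a₂ u v (above-x⇒above-y a₂ a₁<a₂) u∈Xy v∈X
    separated a₁ a₂ u v a₁<a₂ u∈ v∈ | inj₂ (_ , u∈X) | inj₁ (refl , v∈t) with t⊆ v∈t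
    ...   | inj₁ v∈Xx = sepX a₁ x u v a₁<a₂ u∈X v∈Xx
    ...   | inj₂ v∈Xy = sepX a₁ y u v (below-x⇒below-y a₁ a₁<a₂) u∈X v∈Xy
    separated a₁ a₂ u v a₁<a₂ u∈ v∈ | inj₂ (_ , u∈X) | inj₂ (_ , v∈X) = sepX a₁ a₂ u v a₁<a₂ u∈X v∈X

  B : ℕ
  B = size P * size Q

  dim≤B : ∀ (X : C) → cellDim {P} {Q} X ≤ B
  dim≤B X = Dimension.dimSum-bound X

  YinX : C → Set
  YinX X = lookup X y ⊆ lookup X x

  join : C → C
  join X = X [ x ]≔ (lookup X x ∪ lookup X y)

  join∈Hom : ∀ {X} → HomCell P Q X → HomCell P Q (join X)
  join∈Hom {X} h = replace-x∈Hom X _ h (Subset.x∈p∪q⁻ _ _)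
    (proj₁ (proj₁ h x) , Subset.x∈p∪q⁺ (inj₁ (proj₂ (proj₁ h x))))

  join-YinX : ∀ X → YinX (join X)
  join-YinX X {u} u∈ = subst (u ∈_) (sym (lookup-x X _))
    (Subset.x∈p∪q⁺ (inj₂ (subst (u ∈_) (lookup-other X _ y y≢x) u∈)))

  ⊑join : ∀ X → X ⊑ᶜ join X
  ⊑join X = ⊑-replaced {X} {X} (Subset.x∈p∪q⁺ ∘ inj₁) (λ _ _ → id)

  below-join : ∀ {X} → ¬ YinX X → X ⊏ᶜ join X
  below-join {X} ¬YinX = ⊑join X , λ X≡join → ¬YinX λ {u} u∈ →
    subst (λ Z → u ∈ lookup Z x) (sym X≡join) (join-YinX X (subst (λ Z → u ∈ lookup Z y) X≡join u∈))

  join-least : ∀ {X Z} → X ⊑ᶜ Z → YinX Z → join X ⊑ᶜ Z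
  join-least {X} {Z} X⊑Z YinZ =
    replaced-⊑ {X} {Z} (λ u∈ → Sum.[ X⊑Z x , YinZ ∘ X⊑Z y ] (Subset.x∈p∪q⁻ (lookup X x) (lookup X y) u∈))
               (λ b _ → X⊑Z b)

  stage₁ : Collapses (_⊆ˡ_ {P} {Q}) (chainDim {P} {Q}) (BdHom P Q) (BdSimplex P Q (λ X → HomCell P Q X × YinX X))
  stage₁ = ClosureCollapse.closure-collapse cell-≟ _⊏ᶜ_ ⊏-trans ⊏-irrefl _⊏?_ record
    { K? = homCell?
    ; F? = λ X → lookup X y Subset.⊆? lookup X x
    ; closure = join
    ; closure∈K = λ {X} → join∈Hom {X}
    ; closure∈F = λ {X} _ → join-YinX X
    ; below-closure = λ {X} _ → below-join {X}
    ; closure-least = λ { {X} {Z} _ _ _ YinZ (X⊑Z , _) → ⊑⇒≡⊎⊏ (join-least {X} {Z} X⊑Z YinZ) }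
    ; height = cellDim {P} {Q}
    ; height-mono = λ h _ → dim-strict h
    ; maxHeight = B
    ; height≤max = λ {X} _ → dim≤B X
    ; cells = allCells P Q
    ; cells-complete = λ {X} _ → allCells-complete {P} {Q} X }

  -- Stage 2: on cells with X_y ⊆ X_x, the lower closure X ↦ X[x := X_y] onto
  -- {X_x = X_y}; this is an upper closure for the opposite order _⊐_.
  _⊐_ : C → C → Set
  _⊐_ = flip _⊏ᶜ_

  XisY : C → Set
  XisY X = lookup X x ≡ lookup X y

  HomYinX : C → Set
  HomYinX X = HomCell P Q X × YinX X

  squash : C → C
  squash X = X [ x ]≔ lookup X y

  lookup-squash-y : ∀ X → lookup (squash X) y ≡ lookup X y
  lookup-squash-y X = lookup-other X _ y y≢x

  squash∈K : ∀ {X} → HomYinX X → HomYinX (squash X)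
  squash∈K {X} (h , _) = replace-x∈Hom X (lookup X y) h inj₂ (proj₁ h y) ,
    λ {u} u∈ → subst (u ∈_) (sym (lookup-x X _)) (subst (u ∈_) (lookup-squash-y X) u∈)

  squash-XisY : ∀ X → XisY (squash X)
  squash-XisY X = trans (lookup-x X _) (sym (lookup-squash-y X))

  squash⊑ : ∀ {X} → YinX X → squash X ⊑ᶜ X
  squash⊑ {X} YinX = replaced-⊑ {X} {X} YinX (λ _ _ → id)

  above-squash : ∀ {X} → HomYinX X → ¬ XisY X → X ⊐ squash X
  above-squash {X} (_ , YinX) ¬XisY =
    squash⊑ {X} YinX , λ squash≡X → ¬XisY (trans (sym (cong (λ Z → lookup Z x) squash≡X)) (lookup-x X _))

  squash-greatest : ∀ {X Z} → Z ⊑ᶜ X → XisY Z → Z ⊑ᶜ squash X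
  squash-greatest {X} {Z} Z⊑X ZisY = ⊑-replaced {X} {Z} (λ {u} u∈ → Z⊑X y (subst (u ∈_) ZisY u∈)) (λ b _ → Z⊑X b)

  module Opposite = ClosureCollapse cell-≟ _⊐_ (λ Y⊏X Z⊏Y → ⊏-trans Z⊏Y Y⊏X) ⊏-irrefl (flip _⊏?_)

  stage₂-opposite : Collapses SL._⊆_ (λ S → length S ∸ 1)
                      (Opposite.Chain HomYinX) (Opposite.Chain λ X → HomYinX X × XisY X)
  stage₂-opposite = Opposite.closure-collapse record
    { K? = λ X → homCell? X ×-dec (lookup X y Subset.⊆? lookup X x)
    ; F? = λ X → subset-≟ (lookup X x) (lookup X y)
    ; closure = squash
    ; closure∈K = λ {X} → squash∈K {X}
    ; closure∈F = λ {X} _ → squash-XisY X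
    ; below-closure = λ {X} → above-squash {X}
    ; closure-least = λ { {X} {Z} _ _ _ ZisY (Z⊑X , _) →
        Data.Sum.map sym id (⊑⇒≡⊎⊏ (squash-greatest {X} {Z} Z⊑X ZisY)) }
    ; height = λ X → B ∸ cellDim {P} {Q} X
    ; height-mono = λ {X} {Z} _ (hZ , _) Z⊏X → ℕ.∸-monoʳ-< (dim-strict hZ Z⊏X) (dim≤B X)
    ; maxHeight = B
    ; height≤max = λ {X} _ → ℕ.m∸n≤m B (cellDim {P} {Q} X)
    ; cells = allCells P Q
    ; cells-complete = λ {X} _ → allCells-complete {P} {Q} X }

  reverse-chain : ∀ {K₁ K₂ : C → Set} → (∀ {X} → K₁ X → K₂ X) → (∀ {X} → K₂ X → K₁ X) → ∀ S →
                  Opposite.Chain K₁ (reverse S) ⇔ BdSimplex P Q K₂ S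
  reverse-chain {K₁} {K₂} K₁⇒K₂ K₂⇒K₁ S = mk⇔ to from
    where
    open ListFacts
    involutive : reverse (reverse S) ≡ S
    involutive = List.reverse-involutive S
    to : Opposite.Chain K₁ (reverse S) → BdSimplex P Q K₂ S
    to (nonempty , K₁-all , decreasing) =
      (λ S≡[] → nonempty (cong reverse S≡[])) ,
      subst (All K₂) involutive (All.map K₁⇒K₂ (Reverse.all-reverse _⊐_ (λ Y⊏X Z⊏Y → ⊏-trans Z⊏Y Y⊏X) K₁-all)) ,
      subst (Linked _⊏ᶜ_) involutive (Reverse.linked-reverse _⊐_ (λ Y⊏X Z⊏Y → ⊏-trans Z⊏Y Y⊏X) decreasing)
    from : BdSimplex P Q K₂ S → Opposite.Chain K₁ (reverse S)
    from (nonempty , K₂-all , increasing) =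
      (λ rev≡[] → nonempty (trans (sym involutive) (cong reverse rev≡[]))) ,
      All.map K₂⇒K₁ (Reverse.all-reverse _⊏ᶜ_ ⊏-trans K₂-all) ,
      Reverse.linked-reverse _⊏ᶜ_ ⊏-trans increasing

  open CollapseCalculus (_⊆ˡ_ {P} {Q}) (chainDim {P} {Q})

  stage₂ : Collapses (_⊆ˡ_ {P} {Q}) (chainDim {P} {Q}) (BdSimplex P Q HomYinX) (BdHomFold P Q x y)
  stage₂ =
    collapse-respʳ (reverse-chain (λ ((h , _) , XisY) → h , XisY)
                                  (λ {X} (h , XisY) → (h , λ {u} u∈ → subst (u ∈_) (sym XisY) u∈) , XisY))
      (collapse-respˡ (reverse-chain id id)
        (collapse-transport reverse List.reverse-involutive SL.reverse⁺
                            (λ S → cong (_∸ 1) (List.length-reverse S)) stage₂-opposite))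

  bd-collapse : Collapses (_⊆ˡ_ {P} {Q}) (chainDim {P} {Q}) (BdHom P Q) (BdHomFold P Q x y)
  bd-collapse = collapse-trans stage₁ stage₂

theorem3p7 : (P Q : FinPoset) (x y : Fin (size P)) →
    y ≢ x →
    (∀ w → Covers P x w → Covers P y w) →
    (∀ w → Covers P w x → Covers P w y) →
    Collapses (_⊆ˡ_ {P} {Q}) (chainDim {P} {Q}) (BdHom P Q) (BdHomFold P Q x y)
    × Collapses (_⊑_ {Q} {P}) (cellDim {Q} {P}) (HomCx Q P) (HomAvoid Q P x)
theorem3p7 P Q x y y≢x up down =
  BdFold.bd-collapse P Q x y y≢x up down , HomFold.hom-collapse P Q x y y≢x up down
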